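{- Let $L=(e_1,\dots,e_N)$ and $C_n$ ($n\ge0$) be as below, and let $f(x)=1-\sum_{k=1}^{N-1}e_kx^k-(1+e_N)x^N$. Then the generating function $p(x)=\sum_{k=0}^\infty C_kx^k$ coincides with $(1-x^N)/f(x)$ on an open interval containing $0$.
   Context: A coefficient function is a sequence $\mu=(\mu_1,\mu_2,\dots)$ of non-negative integers; $0$ is the zero coefficient function; sums are entrywise. $L=(e_1,\dots,e_N)$ is a list of non-negative integers with $N\ge2$ and $e_1\ne0$. For $n\ge1$, the maximal $L^*$-block at index $n$ is the coefficient function $\bar\beta^n$ with $\bar\beta^n_k=0$ for $k<n$ and $\bar\beta^n_k=e_j$ for $k\ge n$, where $1\le j\le N$ and $k-n+1\equiv j\pmod N$. A proper $L^*$-block at index $n$ is a coefficient function $\zeta$ such that for some $k\ge n$: $\zeta_j=\bar\beta^n_j$ for all $j<k$, $\zeta_k<\bar\beta^n_k$, and $\zeta_j=0$ for $j>k$; its support interval is $[n,k]$ (the zero coefficient function is allowed). For $n\ge1$, $S_n$ is the set of coefficient functions $\epsilon=\sum_{m=1}^\ell\zeta^m$ ($\ell\ge1$) with $\zeta^m$ proper $L^*$-blocks at indices $i_1<\dots<i_\ell$ with pairwise disjoint support intervals, the support interval of $\zeta^\ell$ being $[i,n]$ for some $i\le n$; $S_0=\{0\}$; $C_n=\#S_n$. (These satisfy $C_k=\sum_{j=1}^ke_jC_{k-j}$ for $1\le k\le N$ and $C_n=\sum_{k=1}^{N-1}e_kC_{n-k}+(1+e_N)C_{n-N}$ for $n\ge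 N+1$.)
   Formalization: The identity of p(x) with (1−x^N)/f(x) is asserted only at rational x below some positive rational radius in absolute value, with convergence of the series taken in ℚ. -}

module Defs where

open import Data.Nat as ℕ using (ℕ; zero; suc; _%_; _∸_)
open import Data.Fin as Fin using (Fin; fromℕ)
open import Relation.Nullary using (yes; no)
open import Data.Integer using (+_)
open import Data.List using (tabulate)
open import Data.Nat.ListAction using (sum)
open import Data.Product using (Σ; ∃; _×_; _,_)
open import Data.Sum using (_⊎_)
open import Relation.Binary.PropositionalEquality using (_≡_; _≢_)
open import Data.Rational as ℚ using (ℚ; 0ℚ; 1ℚ; ∣_∣; _-_)

-- A coefficient function μ = (μ₁, μ₂, …) is represented as a function
-- ℕ → ℕ; index 0 is unused (all coefficient functions considered below
-- vanish there).
CoeffFun : Set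
CoeffFun = ℕ → ℕ

_≗c_ : CoeffFun → CoeffFun → Set
μ ≗c ν = ∀ k → μ k ≡ ν k

-- The list L = (e₁,…,eₙ) is given as a function e : ℕ → ℕ of which only
-- the values e 1, …, e N are used.

jIdx : ℕ → ℕ → ℕ
jIdx zero    t = 0
jIdx (suc m) t = suc (t % suc m)

maxBlock : (N : ℕ) → (ℕ → ℕ) → ℕ → CoeffFun
maxBlock N e n k with k ℕ.<? n
... | yes _ = 0
... | no  _ = e (jIdx N (k ∸ n))

ProperBlock : (N : ℕ) → (ℕ → ℕ) → (n k : ℕ) → CoeffFun → Set
ProperBlock N e n k ζ =
  (n ℕ.≤ k)
  × (∀ j → j ℕ.< k → ζ j ≡ maxBlock N e n j)
  × (ζ k ℕ.< maxBlock N e n k)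
  × (∀ j → k ℕ.< j → ζ j ≡ 0)

record Decomp (N : ℕ) (e : ℕ → ℕ) (n : ℕ) (ε : CoeffFun) : Set where
  field
    m     : ℕ
    idx   : Fin (suc m) → ℕ
    end   : Fin (suc m) → ℕ
    block : Fin (suc m) → CoeffFun
    idx≥1 : ∀ a → 1 ℕ.≤ idx a
    proper : ∀ a → ProperBlock N e (idx a) (end a) (block a)
    increasing : ∀ a b → a Fin.< b → idx a ℕ.< idx b
    disjoint : ∀ a b → a ≢ b → (end a ℕ.< idx b) ⊎ (end b ℕ.< idx a)
    last : end (fromℕ m) ≡ n
    isSum : ∀ j → ε j ≡ sum (tabulate (λ a → block a j))

InS : (N : ℕ) → (ℕ → ℕ) → ℕ → CoeffFun → Set
InS N e zero    ε = ∀ j → ε j ≡ 0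
InS N e (suc n) ε = Decomp N e (suc n) ε

HasCard : (CoeffFun → Set) → ℕ → Set
HasCard P c =
  Σ (Fin c → CoeffFun) λ g →
    (∀ a → P (g a))
    × (∀ a b → g a ≗c g b → a ≡ b)
    × (∀ ε → P ε → ∃ λ a → ε ≗c g a)

_^ℚ_ : ℚ → ℕ → ℚ
x ^ℚ zero  = 1ℚ
x ^ℚ suc k = x ℚ.* (x ^ℚ k)

sumQ : (ℕ → ℚ) → ℕ → ℚ
sumQ a zero    = 0ℚ
sumQ a (suc m) = sumQ a m ℚ.+ a m

SeriesConvergesTo : (ℕ → ℚ) → ℚ → Set
SeriesConvergesTo a s =
  ∀ (ε : ℚ) → 0ℚ ℚ.< ε → ∃ λ M → ∀ m → M ℕ.≤ m → ∣ sumQ a m - s ∣ ℚ.< ε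

fPoly : (N : ℕ) → (ℕ → ℕ) → ℚ → ℚ
fPoly N e x =
  (1ℚ - sumQ (λ k → (ℕ→ℚ (e (suc k))) ℚ.* (x ^ℚ suc k)) (N ∸ 1))
    - (ℕ→ℚ (suc (e N)) ℚ.* (x ^ℚ N))
  where
  ℕ→ℚ : ℕ → ℚ
  ℕ→ℚ n = + n ℚ./ 1

-- Splitting off the first block identifies S_n (n ≥ 1) with the triples (L, v, ε″) where
-- 1 ≤ L ≤ n, v < β̄¹_L and ε″ ∈ S_{n−L}; a decomposition whose first block starts after
-- index 1 is read as one starting with the zero block on [1,1], which is proper because
-- e₁ ≠ 0.  Hence C₀ = 1 and C_n = Σ_{L=1}^{n} β̄¹_L C_{n−L}.  Since β̄¹ is N-periodic with
-- β̄¹_L = e_L for L ≤ N, this becomes C_n + [n = N] = Σ_{k=1}^{N} a_k C_{n−k} + [n = 0] with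
-- a_k = e_k + [k = N], the coefficientwise form of f(x) p(x) = 1 − x^N.  It bounds
-- C_n ≤ B^n for B = 1 + Σ_k a_k, and for |x| < 1/(2B) the partial sums s_m of p satisfy
-- f(x) s_m = 1 − x^N − W_m with |W_m| ≤ N B (B|x|)^m ≤ N B 2^(−m), while |f(x)| ≥ 1/2.

{-# OPTIONS --safe #-}
module Submission where

open import Defs
open import Data.Nat as ℕ using (ℕ)

module Sequences where

  open import Data.Nat using (zero; suc; _+_; _*_; _∸_; _<_; _≤_; z≤n; s≤s⁻¹)
  open import Data.Nat.Properties
  open import Data.Sum using (inj₁; inj₂)
  open import Relation.Nullary using (contradiction)
  open import Relation.Binary.PropositionalEquality

  sumℕ : (ℕ → ℕ) → ℕ → ℕ
  sumℕ f zero    = 0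
  sumℕ f (suc n) = sumℕ f n + f n

  δ : ℕ → ℕ → ℕ
  δ zero    zero    = 1
  δ zero    (suc n) = 0
  δ (suc m) zero    = 0
  δ (suc m) (suc n) = δ m n

  prev : (ℕ → ℕ) → ℕ → ℕ
  prev c zero    = 0
  prev c (suc n) = c n

  prev-∸ : ∀ c {n i} → i ≤ n → prev c (suc n ∸ i) ≡ c (n ∸ i)
  prev-∸ c {n} i≤n = cong (prev c) (+-∸-assoc 1 i≤n)

  prev-∸-≥ : ∀ c {n i} → n ≤ i → prev c (n ∸ i) ≡ 0
  prev-∸-≥ c n≤i = cong (prev c) (m≤n⇒m∸n≡0 n≤i)

  δ-refl : ∀ n → δ n n ≡ 1
  δ-refl zero    = refl
  δ-refl (suc n) = δ-refl n

  δ-≢ : ∀ {m n} → m ≢ n → δ m n ≡ 0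
  δ-≢ {zero}  {zero}  m≢n = contradiction refl m≢n
  δ-≢ {zero}  {suc n} m≢n = refl
  δ-≢ {suc m} {zero}  m≢n = refl
  δ-≢ {suc m} {suc n} m≢n = δ-≢ (λ m≡n → m≢n (cong suc m≡n))

  sumℕ-cong : ∀ n {f g : ℕ → ℕ} → (∀ i → i < n → f i ≡ g i) → sumℕ f n ≡ sumℕ g n
  sumℕ-cong zero    f≡g = refl
  sumℕ-cong (suc n) f≡g = cong₂ _+_ (sumℕ-cong n (λ i i<n → f≡g i (m<n⇒m<1+n i<n))) (f≡g n ≤-refl)

  sumℕ-const : ∀ c n → sumℕ (λ _ → c) n ≡ n * c
  sumℕ-const c zero    = refl
  sumℕ-const c (suc n) = trans (cong (_+ c) (sumℕ-const c n)) (+-comm (n * c) c)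

  sumℕ-*ʳ : ∀ f y n → sumℕ (λ i → f i * y) n ≡ sumℕ f n * y
  sumℕ-*ʳ f y zero    = refl
  sumℕ-*ʳ f y (suc n) = trans (cong (_+ f n * y) (sumℕ-*ʳ f y n)) (sym (*-distribʳ-+ y (sumℕ f n) (f n)))

  sumℕ-mono-≤ : ∀ n {f g : ℕ → ℕ} → (∀ i → i < n → f i ≤ g i) → sumℕ f n ≤ sumℕ g n
  sumℕ-mono-≤ zero    f≤g = z≤n
  sumℕ-mono-≤ (suc n) f≤g = +-mono-≤ (sumℕ-mono-≤ n (λ i i<n → f≤g i (m<n⇒m<1+n i<n))) (f≤g n ≤-refl)

  sumℕ-split : ∀ f m n → sumℕ f (m + n) ≡ sumℕ f m + sumℕ (λ i → f (m + i)) n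
  sumℕ-split f m zero    = trans (cong (sumℕ f) (+-identityʳ m)) (sym (+-identityʳ _))
  sumℕ-split f m (suc n) = trans (cong (sumℕ f) (+-suc m n))
    (trans (cong (_+ f (m + n)) (sumℕ-split f m n)) (+-assoc (sumℕ f m) _ _))

  sumℕ-extend : ∀ {f m n} → m ≤ n → (∀ i → m ≤ i → i < n → f i ≡ 0) → sumℕ f n ≡ sumℕ f m
  sumℕ-extend {n = zero} z≤n f≡0 = refl
  sumℕ-extend {f} {m} {suc n} m≤1+n f≡0 with m≤n⇒m<n∨m≡n m≤1+n
  ... | inj₂ refl  = refl
  ... | inj₁ m<1+n = begin
    sumℕ f n + f n ≡⟨ cong (sumℕ f n +_) (f≡0 n (s≤s⁻¹ m<1+n) ≤-refl) ⟩
    sumℕ f n + 0   ≡⟨ +-identityʳ _ ⟩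
    sumℕ f n       ≡⟨ sumℕ-extend (s≤s⁻¹ m<1+n) (λ i m≤i i<n → f≡0 i m≤i (m<n⇒m<1+n i<n)) ⟩
    sumℕ f m       ∎
    where open ≡-Reasoning

module Cardinality where

  open Sequences using (sumℕ)
  open import Data.Nat using (zero; suc; _+_; _<_; _≤_; s≤s)
  open import Data.Nat.Properties using (≤-antisym; ≤-refl; m<n⇒m<1+n; m≤n⇒m<n∨m≡n)
  open import Data.Fin using (Fin; splitAt; _↑ˡ_; _↑ʳ_)
  open import Data.Fin.Properties using (injective⇒≤; splitAt⁻¹-↑ˡ; splitAt⁻¹-↑ʳ; splitAt-↑ˡ; splitAt-↑ʳ)
  open import Data.Product using (Σ; ∃; _×_; _,_; proj₁; proj₂)
  open import Data.Sum using (_⊎_; inj₁; inj₂; [_,_]′)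
  open import Data.Empty using (⊥-elim)
  open import Relation.Nullary using (¬_)
  open import Relation.Binary.PropositionalEquality

  ≗c-sym : ∀ {μ ν} → μ ≗c ν → ν ≗c μ
  ≗c-sym μ≗ν k = sym (μ≗ν k)

  ≗c-trans : ∀ {μ ν ρ} → μ ≗c ν → ν ≗c ρ → μ ≗c ρ
  ≗c-trans μ≗ν ν≗ρ k = trans (μ≗ν k) (ν≗ρ k)

  HasCard-≤ : ∀ {P : CoeffFun → Set} {c d} → HasCard P c → HasCard P d → c ≤ d
  HasCard-≤ {c = c} {d} (g , Pg , g-inj , _) (h , _ , _ , h-onto) = injective⇒≤ {f = φ} φ-inj
    where
    φ : Fin c → Fin d
    φ a = proj₁ (h-onto (g a) (Pg a))
    φ-inj : ∀ {a b} → φ a ≡ φ b → a ≡ b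
    φ-inj {a} {b} φa≡φb = g-inj a b (≗c-trans (proj₂ (h-onto (g a) (Pg a)))
      (≗c-trans (λ k → cong (λ z → h z k) φa≡φb) (≗c-sym (proj₂ (h-onto (g b) (Pg b))))))

  HasCard-unique : ∀ {P : CoeffFun → Set} {c d} → HasCard P c → HasCard P d → c ≡ d
  HasCard-unique p q = ≤-antisym (HasCard-≤ p q) (HasCard-≤ q p)

  HasCard-resp : ∀ {P Q : CoeffFun → Set} {c} → (∀ ε → P ε → Q ε) → (∀ ε → Q ε → P ε) →
    HasCard P c → HasCard Q c
  HasCard-resp P⇒Q Q⇒P (g , Pg , g-inj , g-onto) =
    g , (λ a → P⇒Q _ (Pg a)) , g-inj , λ ε Qε → g-onto ε (Q⇒P ε Qε)

  HasCard-empty : ∀ {P : CoeffFun → Set} → (∀ ε → ¬ P ε) → HasCard P 0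
  HasCard-empty ¬P = (λ ()) , (λ ()) , (λ ()) , λ ε Pε → ⊥-elim (¬P ε Pε)

  HasCard-⊎ : ∀ {P Q : CoeffFun → Set} {a b} → HasCard P a → HasCard Q b →
    (∀ ε ε′ → P ε → Q ε′ → ¬ (ε ≗c ε′)) → HasCard (λ ε → P ε ⊎ Q ε) (a + b)
  HasCard-⊎ {P} {Q} {a} {b} (g , Pg , g-inj , g-onto) (h , Qh , h-inj , h-onto) P∩Q=∅ =
    G , PQG , G-inj , G-onto
    where
    G : Fin (a + b) → CoeffFun
    G i = [ g , h ]′ (splitAt a i)
    PQG : ∀ i → P (G i) ⊎ Q (G i)
    PQG i with splitAt a i
    ... | inj₁ x = inj₁ (Pg x)
    ... | inj₂ y = inj₂ (Qh y)
    G-inj : ∀ i j → G i ≗c G j → i ≡ j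
    G-inj i j Gi≗Gj with splitAt a i in eqi | splitAt a j in eqj
    ... | inj₁ x | inj₁ y = trans (sym (splitAt⁻¹-↑ˡ eqi)) (trans (cong (_↑ˡ b) (g-inj x y Gi≗Gj)) (splitAt⁻¹-↑ˡ eqj))
    ... | inj₂ x | inj₂ y = trans (sym (splitAt⁻¹-↑ʳ eqi)) (trans (cong (a ↑ʳ_) (h-inj x y Gi≗Gj)) (splitAt⁻¹-↑ʳ eqj))
    ... | inj₁ x | inj₂ y = ⊥-elim (P∩Q=∅ _ _ (Pg x) (Qh y) Gi≗Gj)
    ... | inj₂ x | inj₁ y = ⊥-elim (P∩Q=∅ _ _ (Pg y) (Qh x) (≗c-sym Gi≗Gj))
    G-onto : ∀ ε → P ε ⊎ Q ε → ∃ λ i → ε ≗c G i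
    G-onto ε (inj₁ Pε) with g-onto ε Pε
    ... | x , ε≗gx = x ↑ˡ b , λ k → trans (ε≗gx k) (cong (λ z → [ g , h ]′ z k) (sym (splitAt-↑ˡ a x b)))
    G-onto ε (inj₂ Qε) with h-onto ε Qε
    ... | y , ε≗hy = a ↑ʳ y , λ k → trans (ε≗hy k) (cong (λ z → [ g , h ]′ z k) (sym (splitAt-↑ʳ a b y)))

  HasCard-Σ< : (P : ℕ → CoeffFun → Set) (c : ℕ → ℕ) (n : ℕ) →
    (∀ i → i < n → HasCard (P i) (c i)) →
    (∀ i j ε ε′ → i < j → j < n → P i ε → P j ε′ → ¬ (ε ≗c ε′)) →
    HasCard (λ ε → Σ ℕ λ i → i < n × P i ε) (sumℕ c n)
  HasCard-Σ< P c zero    _     _        = HasCard-empty λ { ε (i , () , _) }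
  HasCard-Σ< P c (suc n) cards disjoint =
    HasCard-resp to from (HasCard-⊎
      (HasCard-Σ< P c n (λ i i<n → cards i (m<n⇒m<1+n i<n))
                        (λ i j ε ε′ i<j j<n → disjoint i j ε ε′ i<j (m<n⇒m<1+n j<n)))
      (cards n ≤-refl)
      (λ { ε ε′ (i , i<n , Pε) Pε′ → disjoint i n ε ε′ i<n ≤-refl Pε Pε′ }))
    where
    to : ∀ ε → (Σ ℕ λ i → i < n × P i ε) ⊎ P n ε → Σ ℕ λ i → i < suc n × P i ε
    to ε (inj₁ (i , i<n , Pε)) = i , m<n⇒m<1+n i<n , Pε
    to ε (inj₂ Pε)             = n , ≤-refl , Pε
    from : ∀ ε → (Σ ℕ λ i → i < suc n × P i ε) → (Σ ℕ λ i → i < n × P i ε) ⊎ P n ε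
    from ε (i , s≤s i≤n , Pε) with m≤n⇒m<n∨m≡n i≤n
    ... | inj₁ i<n  = inj₁ (i , i<n , Pε)
    ... | inj₂ refl = inj₂ Pε

  HasCard-image : ∀ {P : CoeffFun → Set} {c} (φ : CoeffFun → CoeffFun) →
    (∀ μ ν → μ ≗c ν → φ μ ≗c φ ν) → (∀ μ ν → φ μ ≗c φ ν → μ ≗c ν) →
    HasCard P c → HasCard (λ ε → Σ CoeffFun λ ε′ → P ε′ × ε ≗c φ ε′) c
  HasCard-image φ φ-cong φ-inj (g , Pg , g-inj , g-onto) =
    (λ a → φ (g a)) , (λ a → g a , Pg a , λ k → refl) ,
    (λ a b φga≗φgb → g-inj a b (φ-inj _ _ φga≗φgb)) ,
    λ { ε (ε′ , Pε′ , ε≗φε′) → let (a , ε′≗ga) = g-onto ε′ Pε′ in a , ≗c-trans ε≗φε′ (φ-cong _ _ ε′≗ga) }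

module Shift where

  open import Data.Nat using (zero; suc; _+_; _<_; _≤_; s≤s; _<?_)
  open import Data.Nat.Properties using (+-identityʳ; +-suc; m∸n+n≡m; ≮⇒≥)
  open import Data.Fin using (Fin)
  open import Data.List using (tabulate)
  open import Data.List.Properties using (tabulate-cong)
  open import Data.Nat.ListAction using (sum)
  open import Relation.Nullary using (yes; no)
  open import Relation.Binary.PropositionalEquality

  _⊕_ : CoeffFun → CoeffFun → CoeffFun
  (μ ⊕ ν) k = μ k + ν k

  shift : ℕ → CoeffFun → CoeffFun
  shift zero    ζ j       = ζ j
  shift (suc s) ζ zero    = 0
  shift (suc s) ζ (suc j) = shift s ζ j

  unshift : ℕ → CoeffFun → CoeffFun
  unshift s ζ j = ζ (j + s)

  shift-< : ∀ s ζ j → j < s → shift s ζ j ≡ 0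
  shift-< (suc s) ζ zero    _         = refl
  shift-< (suc s) ζ (suc j) (s≤s j<s) = shift-< s ζ j j<s

  shift-+ : ∀ s ζ j → shift s ζ (j + s) ≡ ζ j
  shift-+ zero    ζ j = cong ζ (+-identityʳ j)
  shift-+ (suc s) ζ j rewrite +-suc j s = shift-+ s ζ j

  ≥-elim : ∀ {s} (P : ℕ → Set) → (∀ j → P (j + s)) → ∀ j → s ≤ j → P j
  ≥-elim {s} P P+s j s≤j = subst P (m∸n+n≡m s≤j) (P+s (j Data.Nat.∸ s))

  shift-cong : ∀ s {μ ν} → μ ≗c ν → shift s μ ≗c shift s ν
  shift-cong zero    μ≗ν j       = μ≗ν j
  shift-cong (suc s) μ≗ν zero    = refl
  shift-cong (suc s) μ≗ν (suc j) = shift-cong s μ≗ν j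

  shift-unshift : ∀ s ζ → (∀ j → j < s → ζ j ≡ 0) → shift s (unshift s ζ) ≗c ζ
  shift-unshift s ζ ζ<s≡0 j with j <? s
  ... | yes j<s = trans (shift-< s _ j j<s) (sym (ζ<s≡0 j j<s))
  ... | no  j≮s = ≥-elim (λ t → shift s (unshift s ζ) t ≡ ζ t) (shift-+ s _) j (≮⇒≥ j≮s)

  shift-zero : ∀ s ζ → (∀ j → ζ j ≡ 0) → ∀ j → shift s ζ j ≡ 0
  shift-zero zero    ζ ζ≡0 j       = ζ≡0 j
  shift-zero (suc s) ζ ζ≡0 zero    = refl
  shift-zero (suc s) ζ ζ≡0 (suc j) = shift-zero s ζ ζ≡0 j

  sum-zero : ∀ m → sum (tabulate {n = m} (λ _ → 0)) ≡ 0
  sum-zero zero    = refl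
  sum-zero (suc m) = sum-zero m

  sum-cong : ∀ {m} {f g : Fin m → ℕ} → (∀ a → f a ≡ g a) → sum (tabulate f) ≡ sum (tabulate g)
  sum-cong f≡g = cong sum (tabulate-cong f≡g)

  shift-sum : ∀ {m} s (f : Fin m → CoeffFun) j →
    shift s (λ k → sum (tabulate (λ a → f a k))) j ≡ sum (tabulate (λ a → shift s (f a) j))
  shift-sum         zero    f j       = refl
  shift-sum {m}     (suc s) f zero    = sym (sum-zero m)
  shift-sum         (suc s) f (suc j) = shift-sum s f j

module Blocks (N : ℕ) (e : ℕ → ℕ) where

  open Shift
  open import Data.Nat using (_+_; _∸_; _<_; _≤_; _<?_)
  open import Data.Nat.Properties
  open import Data.Product using (_,_; proj₁)
  open import Data.Empty using (⊥-elim)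
  open import Relation.Nullary using (yes; no)
  open import Relation.Binary using (tri<; tri≈; tri>)
  open import Relation.Binary.PropositionalEquality

  maxBlock-< : ∀ {i j} → j < i → maxBlock N e i j ≡ 0
  maxBlock-< {i} {j} j<i with j <? i
  ... | yes _   = refl
  ... | no  j≮i = ⊥-elim (j≮i j<i)

  maxBlock-≥ : ∀ {i j} → i ≤ j → maxBlock N e i j ≡ e (jIdx N (j ∸ i))
  maxBlock-≥ {i} {j} i≤j with j <? i
  ... | yes j<i = ⊥-elim (<⇒≱ j<i i≤j)
  ... | no  _   = refl

  maxBlock-+ : ∀ i s j → maxBlock N e (i + s) (j + s) ≡ maxBlock N e i j
  maxBlock-+ i s j with j <? i
  ... | yes j<i = maxBlock-< (+-monoˡ-< s j<i)
  ... | no  j≮i = trans (maxBlock-≥ (+-monoˡ-≤ s (≮⇒≥ j≮i)))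
    (cong (λ t → e (jIdx N t)) (trans (cong₂ _∸_ (+-comm j s) (+-comm i s)) ([m+n]∸[m+o]≡n∸o s j i)))

  properBlock : ℕ → ℕ → ℕ → CoeffFun
  properBlock i k v j with <-cmp j k
  ... | tri< _ _ _ = maxBlock N e i j
  ... | tri≈ _ _ _ = v
  ... | tri> _ _ _ = 0

  properBlock-< : ∀ i k v j → j < k → properBlock i k v j ≡ maxBlock N e i j
  properBlock-< i k v j j<k with <-cmp j k
  ... | tri< _ _ _   = refl
  ... | tri≈ _ j≡k _ = ⊥-elim (<-irrefl j≡k j<k)
  ... | tri> _ _ k<j = ⊥-elim (<-asym j<k k<j)

  properBlock-end : ∀ i k v → properBlock i k v k ≡ v
  properBlock-end i k v with <-cmp k k
  ... | tri< k<k _ _ = ⊥-elim (<-irrefl refl k<k)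
  ... | tri≈ _ _ _   = refl
  ... | tri> _ _ k<k = ⊥-elim (<-irrefl refl k<k)

  properBlock-> : ∀ i k v j → k < j → properBlock i k v j ≡ 0
  properBlock-> i k v j k<j with <-cmp j k
  ... | tri< j<k _ _ = ⊥-elim (<-asym k<j j<k)
  ... | tri≈ _ j≡k _ = ⊥-elim (<-irrefl (sym j≡k) k<j)
  ... | tri> _ _ _   = refl

  ProperBlock⇒≗properBlock : ∀ {i k ζ} → ProperBlock N e i k ζ → ζ ≗c properBlock i k (ζ k)
  ProperBlock⇒≗properBlock {i} {k} {ζ} (_ , below , _ , above) j with <-cmp j k
  ... | tri< j<k _ _    = below j j<k
  ... | tri≈ _ refl _   = refl
  ... | tri> _ _ k<j    = above j k<j

  properBlock-proper : ∀ {i k v} → i ≤ k → v < maxBlock N e i k → ProperBlock N e i k (properBlock i k v)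
  properBlock-proper {i} {k} {v} i≤k v<β =
    i≤k , properBlock-< i k v , subst (_< maxBlock N e i k) (sym (properBlock-end i k v)) v<β , properBlock-> i k v

  ProperBlock-shift : ∀ {i k ζ} s → ProperBlock N e i k ζ → ProperBlock N e (i + s) (k + s) (shift s ζ)
  ProperBlock-shift {i} {k} {ζ} s (i≤k , below , end< , above) =
    +-monoˡ-≤ s i≤k , below′ , subst₂ _<_ (sym (shift-+ s ζ k)) (sym (maxBlock-+ i s k)) end< , above′
    where
    below′ : ∀ j → j < k + s → shift s ζ j ≡ maxBlock N e (i + s) j
    below′ j j<k+s with j <? s
    ... | yes j<s = trans (shift-< s ζ j j<s) (sym (maxBlock-< (≤-trans j<s (m≤n+m s i))))
    ... | no  j≮s = ≥-elim (λ t → t < k + s → shift s ζ t ≡ maxBlock N e (i + s) t)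
      (λ t t+s<k+s → trans (shift-+ s ζ t) (trans (below t (+-cancelʳ-< s t k t+s<k+s)) (sym (maxBlock-+ i s t))))
      j (≮⇒≥ j≮s) j<k+s
    above′ : ∀ j → k + s < j → shift s ζ j ≡ 0
    above′ j k+s<j = ≥-elim (λ t → k + s < t → shift s ζ t ≡ 0)
      (λ t k+s<t+s → trans (shift-+ s ζ t) (above t (+-cancelʳ-< s k t k+s<t+s)))
      j (≤-trans (m≤n+m s k) (<⇒≤ k+s<j)) k+s<j

  ProperBlock-unshift : ∀ {i k ζ} s → s ≤ i → ProperBlock N e i k ζ → ProperBlock N e (i ∸ s) (k ∸ s) (unshift s ζ)
  ProperBlock-unshift {i} {k} {ζ} s s≤i pb = unshift-+ (subst₂ (λ a b → ProperBlock N e a b ζ)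
    (sym (m∸n+n≡m s≤i)) (sym (m∸n+n≡m (≤-trans s≤i (proj₁ pb)))) pb)
    where
    unshift-+ : ∀ {i k} → ProperBlock N e (i + s) (k + s) ζ → ProperBlock N e i k (unshift s ζ)
    unshift-+ {i} {k} (i+s≤k+s , below , end< , above) =
      +-cancelʳ-≤ s i k i+s≤k+s ,
      (λ j j<k → trans (below (j + s) (+-monoˡ-< s j<k)) (maxBlock-+ i s j)) ,
      subst (ζ (k + s) <_) (maxBlock-+ i s k) end< ,
      (λ j k<j → above (j + s) (+-monoˡ-< s k<j))

  ProperBlock-below : ∀ {i k ζ} → ProperBlock N e i k ζ → ∀ j → j < i → ζ j ≡ 0
  ProperBlock-below (i≤k , below , _ , _) j j<i = trans (below j (<-≤-trans j<i i≤k)) (maxBlock-< j<i)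

module Decompositions (N : ℕ) (e : ℕ → ℕ) where

  open Shift
  open Blocks N e
  open import Data.Nat as ℕ using (zero; suc; _+_; _∸_; _<_; _≤_; z≤n; s≤s)
  open import Data.Nat.Properties
  open import Data.Fin as Fin using (Fin; fromℕ)
  import Data.Fin.Properties as Fin
  open import Data.List using (tabulate)
  open import Data.Nat.ListAction using (sum)
  open import Data.Product using (Σ; _×_; _,_; proj₁; proj₂)
  open import Data.Sum using (_⊎_; inj₁; inj₂)
  import Data.Sum as Sum
  open import Data.Empty using (⊥-elim)
  open import Relation.Binary.PropositionalEquality

  module DecompFacts {n ε} (D : Decomp N e n ε) where

    open Decomp D public

    block-below : ∀ a j → j < idx a → block a j ≡ 0
    block-below a = ProperBlock-below (proper a)

    idx≤end : ∀ a → idx a ≤ end a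
    idx≤end a = proj₁ (proper a)

    idx₀≤idx : ∀ a → idx Fin.zero ≤ idx a
    idx₀≤idx Fin.zero    = ≤-refl
    idx₀≤idx (Fin.suc a) = <⇒≤ (increasing Fin.zero (Fin.suc a) (s≤s z≤n))

    idx₀≤n : idx Fin.zero ≤ n
    idx₀≤n = subst (idx Fin.zero ≤_) last (≤-trans (idx₀≤idx (fromℕ m)) (idx≤end (fromℕ m)))

  Decomp-resp : ∀ {n ε ε′} → Decomp N e n ε → ε′ ≗c ε → Decomp N e n ε′
  Decomp-resp D ε′≗ε = record
    { m = m ; idx = idx ; end = end ; block = block ; idx≥1 = idx≥1 ; proper = proper
    ; increasing = increasing ; disjoint = disjoint ; last = last
    ; isSum = λ j → trans (ε′≗ε j) (isSum j) }
    where open Decomp D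

  Decomp⇒InS : ∀ {n ε} → 1 ≤ n → Decomp N e n ε → InS N e n ε
  Decomp⇒InS {suc n} _ D = D

  InS-zero : ∀ n → InS N e (n ∸ n) (λ _ → 0)
  InS-zero n = subst (λ k → InS N e k (λ _ → 0)) (sym (n∸n≡0 n)) (λ _ → refl)

  InS-at-0 : ∀ n ε → InS N e n ε → ε 0 ≡ 0
  InS-at-0 zero    ε ε≡0 = ε≡0 0
  InS-at-0 (suc n) ε D   =
    trans (isSum 0) (trans (sum-cong (λ a → block-below a 0 (idx≥1 a))) (sum-zero (suc m)))
    where open DecompFacts D

  Decomp-single : ∀ L v ε″ → 1 ≤ L → v < maxBlock N e 1 L → (∀ j → ε″ j ≡ 0) →
    Decomp N e L (properBlock 1 L v ⊕ shift L ε″)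
  Decomp-single L v ε″ 1≤L v<β ε″≡0 = record
    { m = 0 ; idx = λ _ → 1 ; end = λ _ → L ; block = λ _ → properBlock 1 L v
    ; idx≥1 = λ _ → ≤-refl
    ; proper = λ _ → properBlock-proper 1≤L v<β
    ; increasing = λ { Fin.zero Fin.zero () }
    ; disjoint = λ { Fin.zero Fin.zero 0≢0 → ⊥-elim (0≢0 refl) }
    ; last = refl
    ; isSum = λ j → cong (properBlock 1 L v j +_) (shift-zero L ε″ ε″≡0 j) }

  Decomp-cons : ∀ L v q ε″ → 1 ≤ L → v < maxBlock N e 1 L → Decomp N e (suc q) ε″ →
    Decomp N e (suc q + L) (properBlock 1 L v ⊕ shift L ε″)
  Decomp-cons L v q ε″ 1≤L v<β D = record
    { m = suc m ; idx = idx′ ; end = end′ ; block = block′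
    ; idx≥1 = idx≥1′ ; proper = proper′ ; increasing = increasing′ ; disjoint = disjoint′
    ; last = cong (_+ L) last
    ; isSum = λ j → cong (properBlock 1 L v j +_) (trans (shift-cong L isSum j) (shift-sum L block j)) }
    where
    open DecompFacts D
    idx′ end′ : Fin (suc (suc m)) → ℕ
    idx′ Fin.zero    = 1
    idx′ (Fin.suc a) = idx a + L
    end′ Fin.zero    = L
    end′ (Fin.suc a) = end a + L
    block′ : Fin (suc (suc m)) → CoeffFun
    block′ Fin.zero    = properBlock 1 L v
    block′ (Fin.suc a) = shift L (block a)
    idx≥1′ : ∀ a → 1 ≤ idx′ a
    idx≥1′ Fin.zero    = ≤-refl
    idx≥1′ (Fin.suc a) = ≤-trans (idx≥1 a) (m≤m+n _ _)
    proper′ : ∀ a → ProperBlock N e (idx′ a) (end′ a) (block′ a)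
    proper′ Fin.zero    = properBlock-proper 1≤L v<β
    proper′ (Fin.suc a) = ProperBlock-shift L (proper a)
    increasing′ : ∀ a b → a Fin.< b → idx′ a < idx′ b
    increasing′ Fin.zero    (Fin.suc b) _   = +-mono-≤ (idx≥1 b) 1≤L
    increasing′ (Fin.suc a) (Fin.suc b) a<b = +-monoˡ-< L (increasing a b (ℕ.s<s⁻¹ a<b))
    disjoint′ : ∀ a b → a ≢ b → (end′ a < idx′ b) ⊎ (end′ b < idx′ a)
    disjoint′ Fin.zero    Fin.zero    a≢b = ⊥-elim (a≢b refl)
    disjoint′ Fin.zero    (Fin.suc b) _   = inj₁ (m<n+m L (idx≥1 b))
    disjoint′ (Fin.suc a) Fin.zero    _   = inj₂ (m<n+m L (idx≥1 a))
    disjoint′ (Fin.suc a) (Fin.suc b) a≢b =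
      Sum.map (+-monoˡ-< L) (+-monoˡ-< L) (disjoint a b (λ a≡b → a≢b (cong Fin.suc a≡b)))

  Decomp-tail : ∀ {n ε m′} (D : Decomp N e n ε) → Decomp.m D ≡ suc m′ →
    Decomp N e n (λ j → sum (tabulate (λ b → Decomp.block D (Fin.suc b) j)))
  Decomp-tail {m′ = m′} D refl = record
    { m = m′ ; idx = λ b → idx (Fin.suc b) ; end = λ b → end (Fin.suc b)
    ; block = λ b → block (Fin.suc b)
    ; idx≥1 = λ b → idx≥1 (Fin.suc b) ; proper = λ b → proper (Fin.suc b)
    ; increasing = λ a b a<b → increasing (Fin.suc a) (Fin.suc b) (s≤s a<b)
    ; disjoint = λ a b a≢b → disjoint (Fin.suc a) (Fin.suc b) (λ eq → a≢b (Fin.suc-injective eq))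
    ; last = last ; isSum = λ j → refl }
    where open Decomp D

  Decomp-unshift : ∀ {n ε} (D : Decomp N e n ε) s → (∀ a → s < Decomp.idx D a) →
    Decomp N e (n ∸ s) (λ j → sum (tabulate (λ a → unshift s (Decomp.block D a) j)))
  Decomp-unshift D s s<idx = record
    { m = m ; idx = λ a → idx a ∸ s ; end = λ a → end a ∸ s
    ; block = λ a → unshift s (block a)
    ; idx≥1 = λ a → m<n⇒0<n∸m (s<idx a)
    ; proper = λ a → ProperBlock-unshift s (<⇒≤ (s<idx a)) (proper a)
    ; increasing = λ a b a<b → ∸-monoˡ-< (increasing a b a<b) (<⇒≤ (s<idx a))
    ; disjoint = λ a b a≢b → Sum.map (λ lt → ∸-monoˡ-< lt (s≤end a)) (λ lt → ∸-monoˡ-< lt (s≤end b)) (disjoint a b a≢b)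
    ; last = cong (_∸ s) last
    ; isSum = λ j → refl }
    where
    open DecompFacts D
    s≤end : ∀ a → s ≤ end a
    s≤end a = ≤-trans (<⇒≤ (s<idx a)) (idx≤end a)

  FirstBlockSplit : ℕ → CoeffFun → Set
  FirstBlockSplit n ε = Σ ℕ λ L → Σ ℕ λ v → Σ CoeffFun λ ε″ →
    (1 ≤ L) × (L ≤ n) × (v < maxBlock N e 1 L) × InS N e (n ∸ L) ε″ × (ε ≗c (properBlock 1 L v ⊕ shift L ε″))

  split⇒InS : ∀ n ε → FirstBlockSplit (suc n) ε → InS N e (suc n) ε
  split⇒InS n ε (L , v , ε″ , 1≤L , L≤n , v<β , ε″∈S , ε≗) with suc n ∸ L in n∸L≡
  ... | zero  = subst (λ k → Decomp N e k ε) (≤-antisym L≤n (m∸n≡0⇒m≤n n∸L≡))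
    (Decomp-resp (Decomp-single L v ε″ 1≤L v<β ε″∈S) ε≗)
  ... | suc q = subst (λ k → Decomp N e k ε) (trans (cong (_+ L) (sym n∸L≡)) (m∸n+n≡m L≤n))
    (Decomp-resp (Decomp-cons L v q ε″ 1≤L v<β ε″∈S) ε≗)

  properBlock-1-1-0-suc : ∀ j → properBlock 1 1 0 (suc j) ≡ 0
  properBlock-1-1-0-suc zero    = properBlock-end 1 1 0
  properBlock-1-1-0-suc (suc j) = properBlock-> 1 1 0 (suc (suc j)) (s≤s (s≤s z≤n))

  split-leading-zero : 0 < maxBlock N e 1 1 → ∀ n ε (D : Decomp N e (suc n) ε) →
    1 < Decomp.idx D Fin.zero → FirstBlockSplit (suc n) ε
  split-leading-zero e₁>0 zero ε D 1<idx₀ = ⊥-elim (<⇒≱ 1<idx₀ (DecompFacts.idx₀≤n D))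
  split-leading-zero e₁>0 (suc q) ε D 1<idx₀ =
    1 , 0 , ε″ , ≤-refl , s≤s z≤n , e₁>0 , Decomp-unshift D 1 (λ a → <-≤-trans 1<idx₀ (idx₀≤idx a)) , ε≗
    where
    open DecompFacts D
    ε″ : CoeffFun
    ε″ j = sum (tabulate (λ a → unshift 1 (block a) j))
    ε≗ : ε ≗c (properBlock 1 1 0 ⊕ shift 1 ε″)
    ε≗ zero    = trans (InS-at-0 (suc (suc q)) ε D)
      (sym (cong (_+ 0) (trans (properBlock-< 1 1 0 0 (s≤s z≤n)) (maxBlock-< {1} {0} (s≤s z≤n)))))
    ε≗ (suc j) = trans (isSum (suc j)) (trans (sum-cong (λ a → cong (block a) (+-comm 1 j)))
      (sym (cong (_+ ε″ j) (properBlock-1-1-0-suc j))))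

  module FirstBlock {n ε} (D : Decomp N e (suc n) ε) (idx₀≡1 : 1 ≡ Decomp.idx D Fin.zero) where

    open DecompFacts D

    L : ℕ
    L = end Fin.zero

    proper₀ : ProperBlock N e 1 L (block Fin.zero)
    proper₀ = subst (λ i → ProperBlock N e i L (block Fin.zero)) (sym idx₀≡1) (proper Fin.zero)

    1≤L : 1 ≤ L
    1≤L = proj₁ proper₀

    v<β : block Fin.zero L < maxBlock N e 1 L
    v<β = proj₁ (proj₂ (proj₂ proper₀))

    L<idx : ∀ b → L < idx (Fin.suc b)
    L<idx b with disjoint Fin.zero (Fin.suc b) (λ ())
    ... | inj₁ L<idx = L<idx
    ... | inj₂ end<1 = ⊥-elim (<⇒≱ (subst (end (Fin.suc b) <_) (sym idx₀≡1) end<1)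
                               (≤-trans (idx≥1 (Fin.suc b)) (idx≤end (Fin.suc b))))

  split-first-block : ∀ n ε (D : Decomp N e (suc n) ε) → 1 ≡ Decomp.idx D Fin.zero → FirstBlockSplit (suc n) ε
  split-first-block n ε D@(record { m = zero }) idx₀≡1 =
    L , block Fin.zero L , (λ _ → 0) , 1≤L , ≤-reflexive last , v<β ,
    subst (λ k → InS N e (suc n ∸ k) (λ _ → 0)) (sym last) (InS-zero (suc n)) , ε≗
    where
    open DecompFacts D
    open FirstBlock D idx₀≡1
    ε≗ : ε ≗c (properBlock 1 L (block Fin.zero L) ⊕ shift L (λ _ → 0))
    ε≗ j = begin
      ε j                                        ≡⟨ isSum j ⟩
      block Fin.zero j + 0                       ≡⟨ +-identityʳ _ ⟩
      block Fin.zero j                           ≡⟨ ProperBlock⇒≗properBlock proper₀ j ⟩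
      properBlock 1 L (block Fin.zero L) j       ≡⟨ sym (+-identityʳ _) ⟩
      properBlock 1 L (block Fin.zero L) j + 0   ≡⟨ cong (properBlock 1 L (block Fin.zero L) j +_) (sym (shift-zero L _ (λ _ → refl) j)) ⟩
      properBlock 1 L (block Fin.zero L) j + shift L (λ _ → 0) j ∎
      where open ≡-Reasoning
  split-first-block n ε D@(record { m = suc m′ }) idx₀≡1 =
    L , block Fin.zero L , ε″ , 1≤L , <⇒≤ L<1+n , v<β ,
    Decomp⇒InS (m<n⇒0<n∸m L<1+n) (Decomp-unshift (Decomp-tail D refl) L L<idx) , ε≗
    where
    open DecompFacts D
    open FirstBlock D idx₀≡1
    L<1+n : L < suc n
    L<1+n = subst (L <_) last (<-≤-trans (L<idx (fromℕ m′)) (idx≤end (Fin.suc (fromℕ m′))))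
    ε″ : CoeffFun
    ε″ j = sum (tabulate (λ b → unshift L (block (Fin.suc b)) j))
    ε≗ : ε ≗c (properBlock 1 L (block Fin.zero L) ⊕ shift L ε″)
    ε≗ j = trans (isSum j) (cong₂ _+_ (ProperBlock⇒≗properBlock proper₀ j)
      (sym (trans (shift-sum L (λ b → unshift L (block (Fin.suc b))) j)
        (sum-cong (λ b → shift-unshift L (block (Fin.suc b)) (λ t t<L → block-below (Fin.suc b) t (<-trans t<L (L<idx b))) j)))))

  InS⇒split : 0 < maxBlock N e 1 1 → ∀ n ε → InS N e (suc n) ε → FirstBlockSplit (suc n) ε
  InS⇒split e₁>0 n ε D with m≤n⇒m<n∨m≡n (Decomp.idx≥1 D Fin.zero)
  ... | inj₁ 1<idx₀ = split-leading-zero e₁>0 n ε D 1<idx₀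
  ... | inj₂ 1≡idx₀ = split-first-block n ε D 1≡idx₀

module Counting (N : ℕ) (e : ℕ → ℕ) (C : ℕ → ℕ) (C-card : ∀ n → HasCard (InS N e n) (C n))
                (e₁>0 : 0 ℕ.< maxBlock N e 1 1) where

  open Sequences using (sumℕ; sumℕ-const)
  open Cardinality
  open Shift
  open Blocks N e
  open Decompositions N e
  open import Data.Nat using (zero; suc; _+_; _*_; _∸_; _<_; z≤n; s≤s)
  open import Data.Nat.Properties using (+-identityˡ; +-identityʳ; +-cancelˡ-≡; <-irrefl)
  open import Data.Fin as Fin using ()
  open import Data.Product using (Σ; _×_; _,_)
  open import Relation.Binary.PropositionalEquality

  C-zero : C 0 ≡ 1
  C-zero = HasCard-unique (C-card 0)
    ((λ _ _ → 0) , (λ _ _ → refl) , (λ { Fin.zero Fin.zero _ → refl }) , λ ε ε≡0 → Fin.zero , ε≡0)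

  join : ℕ → ℕ → CoeffFun → CoeffFun
  join L v ε″ = properBlock 1 L v ⊕ shift L ε″

  join-at : ∀ L v ε″ → ε″ 0 ≡ 0 → join L v ε″ L ≡ v
  join-at L v ε″ ε″₀≡0 = trans (cong₂ _+_ (properBlock-end 1 L v)
    (trans (cong (shift L ε″) (sym (+-identityˡ L))) (trans (shift-+ L ε″ 0) ε″₀≡0))) (+-identityʳ v)

  join-before : ∀ L L′ v ε″ → L < L′ → join L′ v ε″ L ≡ maxBlock N e 1 L
  join-before L L′ v ε″ L<L′ = trans (cong₂ _+_ (properBlock-< 1 L′ v L L<L′) (shift-< L′ ε″ L L<L′)) (+-identityʳ _)

  join-cancel : ∀ L v μ ν → join L v μ ≗c join L v ν → μ ≗c ν
  join-cancel L v μ ν μ≗ν j =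
    trans (sym (shift-+ L μ j)) (trans (+-cancelˡ-≡ _ _ _ (μ≗ν (j + L))) (shift-+ L ν j))

  module _ (n : ℕ) where

    JoinedWith : ℕ → ℕ → CoeffFun → Set
    JoinedWith i v ε = Σ CoeffFun λ ε″ → InS N e (n ∸ suc i) ε″ × ε ≗c join (suc i) v ε″

    FirstBlockOfLength : ℕ → CoeffFun → Set
    FirstBlockOfLength i ε = Σ ℕ λ v → v < maxBlock N e 1 (suc i) × JoinedWith i v ε

    Split : CoeffFun → Set
    Split ε = Σ ℕ λ i → i < n × FirstBlockOfLength i ε

    value-at : ∀ {i v ε} → JoinedWith i v ε → ε (suc i) ≡ v
    value-at {i} {v} (ε″ , ε″∈S , ε≗) = trans (ε≗ (suc i)) (join-at (suc i) v ε″ (InS-at-0 _ ε″ ε″∈S))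

    JoinedWith-card : ∀ i v → HasCard (JoinedWith i v) (C (n ∸ suc i))
    JoinedWith-card i v = HasCard-image (join (suc i) v)
      (λ μ ν μ≗ν j → cong (properBlock 1 (suc i) v j +_) (shift-cong (suc i) μ≗ν j))
      (join-cancel (suc i) v) (C-card (n ∸ suc i))

    FirstBlockOfLength-card : ∀ i → HasCard (FirstBlockOfLength i) (maxBlock N e 1 (suc i) * C (n ∸ suc i))
    FirstBlockOfLength-card i = subst (HasCard (FirstBlockOfLength i)) (sumℕ-const (C (n ∸ suc i)) (maxBlock N e 1 (suc i)))
      (HasCard-Σ< (JoinedWith i) (λ _ → C (n ∸ suc i)) (maxBlock N e 1 (suc i)) (λ v _ → JoinedWith-card i v)
        λ v v′ ε ε′ v<v′ _ ε∈ ε′∈ ε≗ε′ →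
          <-irrefl (trans (sym (value-at ε∈)) (trans (ε≗ε′ (suc i)) (value-at ε′∈))) v<v′)

    Split-card : HasCard Split (sumℕ (λ i → maxBlock N e 1 (suc i) * C (n ∸ suc i)) n)
    Split-card = HasCard-Σ< FirstBlockOfLength (λ i → maxBlock N e 1 (suc i) * C (n ∸ suc i)) n
      (λ i _ → FirstBlockOfLength-card i)
      λ { i i′ ε ε′ i<i′ _ (v , v<β , ε∈) (v′ , _ , ε″ , _ , ε′≗) ε≗ε′ →
          <-irrefl (trans (sym (value-at ε∈))
                     (trans (ε≗ε′ (suc i)) (trans (ε′≗ (suc i)) (join-before (suc i) (suc i′) v′ ε″ (s≤s i<i′))))) v<β }

  C-suc : ∀ n → C (suc n) ≡ sumℕ (λ i → maxBlock N e 1 (suc i) * C (n ∸ i)) (suc n)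
  C-suc n = HasCard-unique (C-card (suc n)) (HasCard-resp from to (Split-card (suc n)))
    where
    to : ∀ ε → InS N e (suc n) ε → Split (suc n) ε
    to ε ε∈S with InS⇒split e₁>0 n ε ε∈S
    ... | suc i , v , ε″ , _ , L≤ , v<β , ε″∈S , ε≗ = i , L≤ , v , v<β , ε″ , ε″∈S , ε≗
    from : ∀ ε → Split (suc n) ε → InS N e (suc n) ε
    from ε (i , i<n , v , v<β , ε″ , ε″∈S , ε≗) = split⇒InS n ε (suc i , v , ε″ , s≤s z≤n , i<n , v<β , ε″∈S , ε≗)

module FiniteRecurrence (N′ : ℕ) (e : ℕ → ℕ) where

  open Sequences
  open import Data.Nat using (zero; suc; _+_; _*_; _∸_; _<_; _≤_; z≤n; s≤s; s≤s⁻¹; _%_)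
  open import Data.Nat.Properties
  open import Data.Nat.DivMod using (m<n⇒m%n≡m; [m+n]%n≡m%n)
  open import Data.Product using (_,_)
  open import Relation.Binary using (tri<; tri≈; tri>)
  open import Relation.Binary.PropositionalEquality

  N : ℕ
  N = suc N′

  w : ℕ → ℕ
  w = maxBlock N e 1

  coeff : ℕ → ℕ
  coeff k = e k + δ k N

  w-suc : ∀ i → w (suc i) ≡ e (suc (i % N))
  w-suc i = Blocks.maxBlock-≥ N e {1} {suc i} (s≤s z≤n)

  w-small : ∀ {i} → i < N → w (suc i) ≡ e (suc i)
  w-small {i} i<N = trans (w-suc i) (cong (λ t → e (suc t)) (m<n⇒m%n≡m {N} {i} i<N))

  w-periodic : ∀ i → w (suc (N + i)) ≡ w (suc i)
  w-periodic i = begin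
    w (suc (N + i))     ≡⟨ w-suc (N + i) ⟩
    e (suc ((N + i) % N)) ≡⟨ cong (λ t → e (suc (t % N))) (+-comm N i) ⟩
    e (suc ((i + N) % N)) ≡⟨ cong (λ t → e (suc t)) ([m+n]%n≡m%n i N) ⟩
    e (suc (i % N))     ≡⟨ sym (w-suc i) ⟩
    w (suc i)           ∎
    where open ≡-Reasoning

  module _ {c : ℕ → ℕ} (c-zero : c 0 ≡ 1)
           (c-suc : ∀ n → c (suc n) ≡ sumℕ (λ i → w (suc i) * c (n ∸ i)) (suc n)) where

    E : ℕ → ℕ
    E n = sumℕ (λ i → e (suc i) * prev c (n ∸ i)) N

    coeff-sum : ∀ n → sumℕ (λ i → coeff (suc i) * prev c (n ∸ i)) N ≡ E n + prev c (n ∸ N′)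
    coeff-sum n = begin
      sumℕ (λ i → coeff (suc i) * P i) N′ + (e N + δ N′ N′) * P N′
        ≡⟨ cong₂ (λ s d → s + (e N + d) * P N′) (sumℕ-cong N′ (λ i i<N′ → cong (λ d → (e (suc i) + d) * P i)
             (δ-≢ (<⇒≢ i<N′)))) (δ-refl N′) ⟩
      sumℕ (λ i → (e (suc i) + 0) * P i) N′ + (e N + 1) * P N′
        ≡⟨ cong₂ _+_ (sumℕ-cong N′ (λ i _ → cong (_* P i) (+-identityʳ (e (suc i))))) ([a+1]*b≡a*b+b (e N) (P N′)) ⟩
      sumℕ (λ i → e (suc i) * P i) N′ + (e N * P N′ + P N′)
        ≡⟨ sym (+-assoc (sumℕ (λ i → e (suc i) * P i) N′) (e N * P N′) (P N′)) ⟩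
      E n + P N′ ∎
      where
      open ≡-Reasoning
      P : ℕ → ℕ
      P i = prev c (n ∸ i)
      [a+1]*b≡a*b+b : ∀ a b → (a + 1) * b ≡ a * b + b
      [a+1]*b≡a*b+b a b = trans (*-distribʳ-+ b a 1) (cong (a * b +_) (*-identityˡ b))

    w-term : ∀ {n i} → i < N → i ≤ n → w (suc i) * c (n ∸ i) ≡ e (suc i) * prev c (suc n ∸ i)
    w-term i<N i≤n = cong₂ _*_ (w-small i<N) (sym (prev-∸ c i≤n))

    c-suc-short : ∀ {n} → n < N → c (suc n) ≡ E (suc n)
    c-suc-short {n} n<N = begin
      c (suc n)                                              ≡⟨ c-suc n ⟩
      sumℕ (λ i → w (suc i) * c (n ∸ i)) (suc n)             ≡⟨ sumℕ-cong (suc n) (λ i i≤n → w-term (<-≤-trans i≤n n<N) (s≤s⁻¹ i≤n)) ⟩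
      sumℕ (λ i → e (suc i) * prev c (suc n ∸ i)) (suc n)    ≡⟨ sym (sumℕ-extend n<N (λ i n<i _ → trans (cong (e (suc i) *_) (prev-∸-≥ c {suc n} {i} n<i)) (*-zeroʳ (e (suc i))))) ⟩
      E (suc n)                                              ∎
      where open ≡-Reasoning

    c-suc-long : ∀ r → c (suc (N + r)) ≡ E (suc (N + r)) + c (suc r)
    c-suc-long r = begin
      c (suc (N + r))
        ≡⟨ c-suc (N + r) ⟩
      sumℕ f (suc (N + r))
        ≡⟨ cong (sumℕ f) (sym (+-suc N r)) ⟩
      sumℕ f (N + suc r)
        ≡⟨ sumℕ-split f N (suc r) ⟩
      sumℕ f N + sumℕ (λ j → f (N + j)) (suc r)
        ≡⟨ cong₂ _+_ (sumℕ-cong N (λ i i<N → w-term i<N (≤-trans (<⇒≤ i<N) (m≤m+n N r))))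
                     (sumℕ-cong (suc r) (λ j _ → cong₂ _*_ (w-periodic j) (cong c ([m+n]∸[m+o]≡n∸o N r j)))) ⟩
      E (suc (N + r)) + sumℕ (λ j → w (suc j) * c (r ∸ j)) (suc r)
        ≡⟨ cong (E (suc (N + r)) +_) (sym (c-suc r)) ⟩
      E (suc (N + r)) + c (suc r) ∎
      where
      open ≡-Reasoning
      f : ℕ → ℕ
      f i = w (suc i) * c (N + r ∸ i)

    c-suc+δ : ∀ n → c (suc n) + δ n N′ ≡ E (suc n) + prev c (suc n ∸ N′)
    c-suc+δ n with <-cmp n N′
    ... | tri< n<N′ n≢N′ _ = cong₂ _+_ (c-suc-short (m<n⇒m<1+n n<N′)) (trans (δ-≢ n≢N′) (sym (prev-∸-≥ c n<N′)))
    ... | tri≈ _ refl _ = cong₂ _+_ (c-suc-short ≤-refl)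
      (trans (δ-refl N′) (sym (trans (prev-∸ c {N′} {N′} ≤-refl) (trans (cong c (n∸n≡0 N′)) c-zero))))
    ... | tri> _ n≢N′ N′<n with m≤n⇒∃[o]m+o≡n N′<n
    ... | r , refl = begin
      c (suc (N + r)) + δ (N + r) N′                ≡⟨ cong₂ _+_ (c-suc-long r) (δ-≢ n≢N′) ⟩
      E (suc (N + r)) + c (suc r) + 0               ≡⟨ +-identityʳ _ ⟩
      E (suc (N + r)) + c (suc r)                   ≡⟨ cong (E (suc (N + r)) +_) (sym (trans (prev-∸ c (≤-trans (n≤1+n N′) (m≤m+n N r)))
                                                         (cong c N+r∸N′≡1+r))) ⟩
      E (suc (N + r)) + prev c (suc (N + r) ∸ N′)   ∎
      where
      open ≡-Reasoning
      N+r∸N′≡1+r : N + r ∸ N′ ≡ suc r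
      N+r∸N′≡1+r = trans (cong (_∸ N′) (sym (+-suc N′ r))) (m+n∸m≡n N′ (suc r))

    recurrence : ∀ n → c n + δ n N ≡ sumℕ (λ i → coeff (suc i) * prev c (n ∸ i)) N + δ n 0
    recurrence zero = begin
      c 0 + 0                                         ≡⟨ cong (_+ 0) c-zero ⟩
      1                                               ≡⟨ cong (_+ 1) (sym (sumℕ-extend z≤n (λ i _ _ →
                                                           trans (cong (coeff (suc i) *_) (prev-∸-≥ c {0} {i} z≤n)) (*-zeroʳ (coeff (suc i)))))) ⟩
      sumℕ (λ i → coeff (suc i) * prev c (0 ∸ i)) N + 1 ∎
      where open ≡-Reasoning
    recurrence (suc n) = begin
      c (suc n) + δ n N′                                        ≡⟨ c-suc+δ n ⟩
      E (suc n) + prev c (suc n ∸ N′)                           ≡⟨ sym (coeff-sum (suc n)) ⟩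
      sumℕ (λ i → coeff (suc i) * prev c (suc n ∸ i)) N         ≡⟨ sym (+-identityʳ _) ⟩
      sumℕ (λ i → coeff (suc i) * prev c (suc n ∸ i)) N + 0     ∎
      where open ≡-Reasoning

module RationalFacts where

  open Sequences using (sumℕ; δ; δ-refl; δ-≢)
  open import Data.Nat as ℕ using (zero; suc)
  import Data.Nat.Properties as ℕ
  open import Data.Integer as ℤ using (+[1+_]; -[1+_])
  import Data.Integer.Properties as ℤ
  open import Data.Nat.Coprimality using (1-coprimeTo; sym)
  open import Data.Rational using (ℚ; mkℚ; 0ℚ; 1ℚ; ½; _+_; _*_; _≤_; _<_; ∣_∣; _/_; 1/_; *≤*; *<*; nonNegative; positive)
  open import Data.Rational.Properties
  open import Data.Rational.Solver using (module +-*-Solver)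
  open +-*-Solver using (solve; _:+_; _:*_; _:=_; con)
  open import Data.Product using (Σ; ∃; _,_)
  open import Data.Sum using (inj₁; inj₂)
  open import Relation.Binary.PropositionalEquality hiding (sym)
  import Relation.Binary.PropositionalEquality as ≡

  toℚ : ℕ → ℚ
  toℚ n = ℤ.+ n / 1

  toℚ-mkℚ : ∀ n → toℚ n ≡ mkℚ (ℤ.+ n) 0 (sym (1-coprimeTo n))
  toℚ-mkℚ n = normalize-coprime (sym (1-coprimeTo n))

  toℚ-+ : ∀ m n → toℚ (m ℕ.+ n) ≡ toℚ m + toℚ n
  toℚ-+ m n rewrite toℚ-mkℚ m | toℚ-mkℚ n = cong (_/ 1)
    (trans (ℤ.pos-+ m n) (≡.sym (cong₂ ℤ._+_ (ℤ.*-identityʳ (ℤ.+ m)) (ℤ.*-identityʳ (ℤ.+ n)))))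

  toℚ-* : ∀ m n → toℚ (m ℕ.* n) ≡ toℚ m * toℚ n
  toℚ-* m n rewrite toℚ-mkℚ m | toℚ-mkℚ n = cong (_/ 1) (ℤ.pos-* m n)

  toℚ-mono-≤ : ∀ {m n} → m ℕ.≤ n → toℚ m ≤ toℚ n
  toℚ-mono-≤ {m} {n} m≤n rewrite toℚ-mkℚ m | toℚ-mkℚ n = *≤* (ℤ.*-monoʳ-≤-nonNeg (ℤ.+ 1) (ℤ.+≤+ m≤n))

  toℚ-mono-< : ∀ {m n} → m ℕ.< n → toℚ m < toℚ n
  toℚ-mono-< {m} {n} m<n rewrite toℚ-mkℚ m | toℚ-mkℚ n = *<* (ℤ.*-monoʳ-<-pos (ℤ.+ 1) (ℤ.+<+ m<n))

  0≤toℚ : ∀ n → 0ℚ ≤ toℚ n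
  0≤toℚ n = toℚ-mono-≤ {0} {n} ℕ.z≤n

  toℚ-sumℕ : ∀ f n → toℚ (sumℕ f n) ≡ sumQ (λ i → toℚ (f i)) n
  toℚ-sumℕ f zero    = refl
  toℚ-sumℕ f (suc n) = trans (toℚ-+ (sumℕ f n) (f n)) (cong (_+ toℚ (f n)) (toℚ-sumℕ f n))

  toℚ-^ : ∀ m n → toℚ (m ℕ.^ n) ≡ toℚ m ^ℚ n
  toℚ-^ m zero    = refl
  toℚ-^ m (suc n) = trans (toℚ-* m (m ℕ.^ n)) (cong (toℚ m *_) (toℚ-^ m n))

  *-monoˡ-≤′ : ∀ {r p q} → 0ℚ ≤ r → p ≤ q → r * p ≤ r * q
  *-monoˡ-≤′ {r} 0≤r = *-monoˡ-≤-nonNeg r {{nonNegative 0≤r}}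

  *-monoʳ-≤′ : ∀ {r p q} → 0ℚ ≤ r → p ≤ q → p * r ≤ q * r
  *-monoʳ-≤′ {r} 0≤r = *-monoʳ-≤-nonNeg r {{nonNegative 0≤r}}

  *-monoˡ-<′ : ∀ {r p q} → 0ℚ < r → p < q → r * p < r * q
  *-monoˡ-<′ {r} 0<r = *-monoʳ-<-pos r {{positive 0<r}}

  *-monoʳ-<′ : ∀ {r p q} → 0ℚ < r → p < q → p * r < q * r
  *-monoʳ-<′ {r} 0<r = *-monoˡ-<-pos r {{positive 0<r}}

  *-mono-≤′ : ∀ {p₁ p₂ q₁ q₂} → 0ℚ ≤ p₁ → 0ℚ ≤ q₁ → p₁ ≤ p₂ → q₁ ≤ q₂ → p₁ * q₁ ≤ p₂ * q₂
  *-mono-≤′ 0≤p₁ 0≤q₁ p₁≤p₂ q₁≤q₂ = ≤-trans (*-monoʳ-≤′ 0≤q₁ p₁≤p₂) (*-monoˡ-≤′ (≤-trans 0≤p₁ p₁≤p₂) q₁≤q₂)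

  0≤* : ∀ {p q} → 0ℚ ≤ p → 0ℚ ≤ q → 0ℚ ≤ p * q
  0≤* {p} 0≤p 0≤q = ≤-trans (≤-reflexive (≡.sym (*-zeroʳ p))) (*-monoˡ-≤′ 0≤p 0≤q)

  0<* : ∀ {p q} → 0ℚ < p → 0ℚ < q → 0ℚ < p * q
  0<* {p} 0<p 0<q = ≤-<-trans (≤-reflexive (≡.sym (*-zeroʳ p))) (*-monoˡ-<′ 0<p 0<q)

  ^ℚ-+ : ∀ x m n → x ^ℚ (m ℕ.+ n) ≡ x ^ℚ m * x ^ℚ n
  ^ℚ-+ x zero    n = ≡.sym (*-identityˡ _)
  ^ℚ-+ x (suc m) n = trans (cong (x *_) (^ℚ-+ x m n)) (≡.sym (*-assoc x _ _))

  ^ℚ-* : ∀ x y n → (x * y) ^ℚ n ≡ x ^ℚ n * y ^ℚ n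
  ^ℚ-* x y zero    = refl
  ^ℚ-* x y (suc n) = trans (cong ((x * y) *_) (^ℚ-* x y n))
    (solve 4 (λ a b c d → (a :* b) :* (c :* d) := (a :* c) :* (b :* d)) refl x y (x ^ℚ n) (y ^ℚ n))

  ∣^ℚ∣ : ∀ x n → ∣ x ^ℚ n ∣ ≡ ∣ x ∣ ^ℚ n
  ∣^ℚ∣ x zero    = refl
  ∣^ℚ∣ x (suc n) = trans (∣p*q∣≡∣p∣*∣q∣ x (x ^ℚ n)) (cong (∣ x ∣ *_) (∣^ℚ∣ x n))

  1^ℚ : ∀ n → 1ℚ ^ℚ n ≡ 1ℚ
  1^ℚ zero    = refl
  1^ℚ (suc n) = trans (*-identityˡ _) (1^ℚ n)

  0≤^ℚ : ∀ {y} n → 0ℚ ≤ y → 0ℚ ≤ y ^ℚ n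
  0≤^ℚ zero    0≤y = <⇒≤ (positive⁻¹ 1ℚ)
  0≤^ℚ (suc n) 0≤y = 0≤* 0≤y (0≤^ℚ n 0≤y)

  0<^ℚ : ∀ {y} n → 0ℚ < y → 0ℚ < y ^ℚ n
  0<^ℚ zero    0<y = positive⁻¹ 1ℚ
  0<^ℚ (suc n) 0<y = 0<* 0<y (0<^ℚ n 0<y)

  ^ℚ-mono-≤ : ∀ {y z} n → 0ℚ ≤ y → y ≤ z → y ^ℚ n ≤ z ^ℚ n
  ^ℚ-mono-≤ zero    0≤y y≤z = ≤-refl
  ^ℚ-mono-≤ (suc n) 0≤y y≤z = *-mono-≤′ 0≤y (0≤^ℚ n 0≤y) y≤z (^ℚ-mono-≤ n 0≤y y≤z)

  ^ℚ-≤1 : ∀ {y} n → 0ℚ ≤ y → y ≤ 1ℚ → y ^ℚ n ≤ 1ℚ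
  ^ℚ-≤1 zero    0≤y y≤1 = ≤-refl
  ^ℚ-≤1 (suc n) 0≤y y≤1 = *-mono-≤′ 0≤y (0≤^ℚ n 0≤y) y≤1 (^ℚ-≤1 n 0≤y y≤1)

  sumQ-cong : ∀ n {f g : ℕ → ℚ} → (∀ i → i ℕ.< n → f i ≡ g i) → sumQ f n ≡ sumQ g n
  sumQ-cong zero    f≡g = refl
  sumQ-cong (suc n) f≡g = cong₂ _+_ (sumQ-cong n (λ i i<n → f≡g i (ℕ.m<n⇒m<1+n i<n))) (f≡g n ℕ.≤-refl)

  sumQ-+ : ∀ n f g → sumQ (λ i → f i + g i) n ≡ sumQ f n + sumQ g n
  sumQ-+ zero    f g = refl
  sumQ-+ (suc n) f g = trans (cong (_+ (f n + g n)) (sumQ-+ n f g))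
    (solve 4 (λ a b c d → (a :+ b) :+ (c :+ d) := (a :+ c) :+ (b :+ d)) refl (sumQ f n) (sumQ g n) (f n) (g n))

  sumQ-*ʳ : ∀ n f y → sumQ (λ i → f i * y) n ≡ sumQ f n * y
  sumQ-*ʳ zero    f y = ≡.sym (*-zeroˡ y)
  sumQ-*ʳ (suc n) f y = trans (cong (_+ f n * y) (sumQ-*ʳ n f y)) (≡.sym (*-distribʳ-+ y (sumQ f n) (f n)))

  sumQ-toℚ-+ : ∀ n (f g : ℕ → ℕ) (y : ℕ → ℚ) →
    sumQ (λ k → toℚ (f k ℕ.+ g k) * y k) n ≡ sumQ (λ k → toℚ (f k) * y k) n + sumQ (λ k → toℚ (g k) * y k) n
  sumQ-toℚ-+ n f g y = trans (sumQ-cong n (λ k _ → trans (cong (_* y k) (toℚ-+ (f k) (g k))) (*-distribʳ-+ (y k) (toℚ (f k)) (toℚ (g k)))))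
    (sumQ-+ n (λ k → toℚ (f k) * y k) (λ k → toℚ (g k) * y k))

  sumQ-zero : ∀ n f → (∀ i → i ℕ.< n → f i ≡ 0ℚ) → sumQ f n ≡ 0ℚ
  sumQ-zero zero    f f≡0 = refl
  sumQ-zero (suc n) f f≡0 = trans (cong₂ _+_ (sumQ-zero n f (λ i i<n → f≡0 i (ℕ.m<n⇒m<1+n i<n))) (f≡0 n ℕ.≤-refl))
    (+-identityʳ 0ℚ)

  sumQ-mono-≤ : ∀ n {f g : ℕ → ℚ} → (∀ i → i ℕ.< n → f i ≤ g i) → sumQ f n ≤ sumQ g n
  sumQ-mono-≤ zero    f≤g = ≤-refl
  sumQ-mono-≤ (suc n) f≤g = +-mono-≤ (sumQ-mono-≤ n (λ i i<n → f≤g i (ℕ.m<n⇒m<1+n i<n))) (f≤g n ℕ.≤-refl)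

  ∣sumQ∣≤sumQ∣∣ : ∀ n f → ∣ sumQ f n ∣ ≤ sumQ (λ i → ∣ f i ∣) n
  ∣sumQ∣≤sumQ∣∣ zero    f = ≤-refl
  ∣sumQ∣≤sumQ∣∣ (suc n) f = ≤-trans (∣p+q∣≤∣p∣+∣q∣ (sumQ f n) (f n)) (+-monoˡ-≤ ∣ f n ∣ (∣sumQ∣≤sumQ∣∣ n f))

  sumQ-δ : ∀ {j n} (f : ℕ → ℚ) → j ℕ.< n → sumQ (λ k → toℚ (δ k j) * f k) n ≡ f j
  sumQ-δ {j} {suc n} f j<1+n with ℕ.m≤n⇒m<n∨m≡n (ℕ.s≤s⁻¹ j<1+n)
  ... | inj₁ j<n = begin
    sumQ (λ k → toℚ (δ k j) * f k) n + toℚ (δ n j) * f n ≡⟨ cong₂ (λ s d → s + toℚ d * f n) (sumQ-δ f j<n) (δ-≢ (ℕ.>⇒≢ j<n)) ⟩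
    f j + 0ℚ * f n                                       ≡⟨ cong (f j +_) (*-zeroˡ (f n)) ⟩
    f j + 0ℚ                                             ≡⟨ +-identityʳ (f j) ⟩
    f j                                                  ∎
    where open ≡-Reasoning
  ... | inj₂ refl = begin
    sumQ (λ k → toℚ (δ k n) * f k) n + toℚ (δ n n) * f n ≡⟨ cong₂ (λ s d → s + toℚ d * f n)
                                                               (sumQ-zero n _ (λ k k<n → trans (cong (λ d → toℚ d * f k) (δ-≢ (ℕ.<⇒≢ k<n))) (*-zeroˡ (f k))))
                                                               (δ-refl n) ⟩
    0ℚ + 1ℚ * f n                                        ≡⟨ solve 1 (λ a → con 0ℚ :+ con 1ℚ :* a := a) refl (f n) ⟩
    f n                                                  ∎
    where open ≡-Reasoning

  n<2^n : ∀ n → n ℕ.< 2 ℕ.^ n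
  n<2^n zero    = ℕ.s≤s ℕ.z≤n
  n<2^n (suc n) = ℕ.≤-trans (ℕ.≤-reflexive (ℕ.+-comm 1 (suc n)))
    (ℕ.+-mono-≤ (n<2^n n) (ℕ.≤-trans (ℕ.m^n>0 2 n) (ℕ.m≤m+n _ 0)))

  archimedean : ∀ ε → 0ℚ < ε → Σ ℕ λ k → 1ℚ ≤ ε * toℚ k
  archimedean ε@(mkℚ +[1+ p ] d _) 0<ε = suc d , ≤-trans (≤-reflexive (≡.sym (*-inverseʳ ε))) (*-monoˡ-≤′ (<⇒≤ 0<ε) 1/ε≤)
    where
    1/ε≤ : 1/ ε ≤ toℚ (suc d)
    1/ε≤ rewrite toℚ-mkℚ (suc d) = *≤* (ℤ.*-monoˡ-≤-nonNeg (ℤ.+ suc d) (ℤ.+≤+ (ℕ.s≤s ℕ.z≤n)))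
  archimedean (mkℚ (ℤ.+ zero) d _) 0<ε with positive 0<ε
  ... | ()
  archimedean (mkℚ -[1+ p ] d _) 0<ε with positive 0<ε
  ... | ()

  geometric-decay : ∀ K ε → 0ℚ < ε → ∃ λ M → ∀ m → M ℕ.≤ m → toℚ K * ½ ^ℚ m < ε
  geometric-decay K ε 0<ε with archimedean ε 0<ε
  ... | k , 1≤εk = K ℕ.* k , λ m Kk≤m → begin-strict
    toℚ K * ½ ^ℚ m                    ≡⟨ ≡.sym (*-identityʳ _) ⟩
    toℚ K * ½ ^ℚ m * 1ℚ               ≤⟨ *-monoˡ-≤′ (0≤* (0≤toℚ K) (0≤^ℚ m (<⇒≤ (positive⁻¹ ½)))) 1≤εk ⟩
    toℚ K * ½ ^ℚ m * (ε * toℚ k)      ≡⟨ solve 4 (λ a h e b → (a :* h) :* (e :* b) := e :* ((a :* b) :* h)) refl (toℚ K) (½ ^ℚ m) ε (toℚ k) ⟩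
    ε * (toℚ K * toℚ k * ½ ^ℚ m)      ≡⟨ cong (λ u → ε * (u * ½ ^ℚ m)) (≡.sym (toℚ-* K k)) ⟩
    ε * (toℚ (K ℕ.* k) * ½ ^ℚ m)      <⟨ *-monoˡ-<′ 0<ε (*-monoʳ-<′ (0<^ℚ m (positive⁻¹ ½)) (toℚ-mono-< (ℕ.≤-<-trans Kk≤m (n<2^n m)))) ⟩
    ε * (toℚ (2 ℕ.^ m) * ½ ^ℚ m)      ≡⟨ cong (λ u → ε * (u * ½ ^ℚ m)) (toℚ-^ 2 m) ⟩
    ε * (toℚ 2 ^ℚ m * ½ ^ℚ m)         ≡⟨ cong (ε *_) (trans (≡.sym (^ℚ-* (toℚ 2) ½ m)) (1^ℚ m)) ⟩
    ε * 1ℚ                            ≡⟨ *-identityʳ ε ⟩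
    ε                                 ∎
    where open ≤-Reasoning

module GeneratingFunction (N : ℕ) (α : ℕ → ℕ) where

  open Sequences
  open RationalFacts
  open import Data.Nat as ℕ using (zero; suc; _∸_)
  import Data.Nat.Properties as ℕ
  open import Data.Nat.Induction using (<-rec)
  open import Data.Rational using (ℚ; 0ℚ; 1ℚ; ½; _+_; _*_; _-_; -_; _≤_; _<_; ∣_∣; _÷_; 1/_; NonZero; ≢-nonZero; >-nonZero; positive; *≤*)
  open import Data.Rational.Properties
  open import Data.Rational.Solver using (module +-*-Solver)
  open +-*-Solver using (solve; _:+_; _:-_; _:*_; :-_; _:=_; con)
  import Data.Integer as ℤ
  open import Data.Product using (Σ; _,_; proj₁; proj₂)
  open import Relation.Binary.PropositionalEquality hiding (sym)
  import Relation.Binary.PropositionalEquality as ≡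

  -- prev c (n ∸ i) is c (n − 1 − i), read as 0 when i ≥ n.
  conv : (ℕ → ℕ) → ℕ → ℕ
  conv c n = sumℕ (λ i → α i ℕ.* prev c (n ∸ i)) N

  F : ℚ → ℚ
  F x = 1ℚ - sumQ (λ i → toℚ (α i) * x ^ℚ suc i) N

  module PartialSums (c : ℕ → ℕ) (x : ℚ) where

    t : ℕ → ℚ
    t k = toℚ (c k) * x ^ℚ k

    s : ℕ → ℚ
    s = sumQ t

    β : ℕ → ℚ
    β i = toℚ (α i) * x ^ℚ suc i

    lagged : ℕ → ℚ
    lagged m = sumQ (λ i → β i * s (m ∸ suc i)) N

    W : ℕ → ℚ
    W m = sumQ (λ i → β i * (s m - s (m ∸ suc i))) N

    lagged-term : ∀ m i → β i * s (m ∸ i) ≡ β i * s (m ∸ suc i) + toℚ (α i ℕ.* prev c (m ∸ i)) * x ^ℚ m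
    lagged-term m i with m ∸ i in m∸i≡
    ... | zero = begin
      β i * 0ℚ                                            ≡⟨ cong (λ k → β i * s k) (≡.sym m∸1+i≡) ⟩
      β i * s (m ∸ suc i)                                 ≡⟨ ≡.sym (+-identityʳ _) ⟩
      β i * s (m ∸ suc i) + 0ℚ                            ≡⟨ cong (β i * s (m ∸ suc i) +_) (≡.sym (*-zeroˡ (x ^ℚ m))) ⟩
      β i * s (m ∸ suc i) + 0ℚ * x ^ℚ m                   ≡⟨ cong (λ k → β i * s (m ∸ suc i) + toℚ k * x ^ℚ m) (≡.sym (ℕ.*-zeroʳ (α i))) ⟩
      β i * s (m ∸ suc i) + toℚ (α i ℕ.* 0) * x ^ℚ m      ∎
      where
      open ≡-Reasoning
      m∸1+i≡ : m ∸ suc i ≡ 0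
      m∸1+i≡ = trans (≡.sym (ℕ.pred[m∸n]≡m∸[1+n] m i)) (cong ℕ.pred m∸i≡)
    ... | suc j = begin
      β i * (s j + t j)                                                   ≡⟨ solve 5 (λ a p S C q → (a :* p) :* (S :+ C :* q) := (a :* p) :* S :+ (a :* C) :* (p :* q))
                                                                               refl (toℚ (α i)) (x ^ℚ suc i) (s j) (toℚ (c j)) (x ^ℚ j) ⟩
      β i * s j + toℚ (α i) * toℚ (c j) * (x ^ℚ suc i * x ^ℚ j)          ≡⟨ cong₂ (λ a p → β i * s j + a * p) (≡.sym (toℚ-* (α i) (c j))) (≡.sym (^ℚ-+ x (suc i) j)) ⟩
      β i * s j + toℚ (α i ℕ.* c j) * x ^ℚ (suc i ℕ.+ j)                 ≡⟨ cong₂ (λ k l → β i * s k + toℚ (α i ℕ.* c j) * x ^ℚ l) (≡.sym m∸1+i≡) 1+i+j≡m ⟩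
      β i * s (m ∸ suc i) + toℚ (α i ℕ.* c j) * x ^ℚ m                   ∎
      where
      open ≡-Reasoning
      m∸1+i≡ : m ∸ suc i ≡ j
      m∸1+i≡ = trans (≡.sym (ℕ.pred[m∸n]≡m∸[1+n] m i)) (cong ℕ.pred m∸i≡)
      1+i+j≡m : suc i ℕ.+ j ≡ m
      1+i+j≡m = trans (≡.sym (ℕ.+-suc i j)) (trans (cong (i ℕ.+_) (≡.sym m∸i≡))
        (ℕ.m+[n∸m]≡n {i} {m} (ℕ.<⇒≤ (ℕ.m∸n≢0⇒n<m (λ m∸i≡0 → ℕ.1+n≢0 (trans (≡.sym m∸i≡) m∸i≡0))))))

    lagged≡sumQ-conv : ∀ m → lagged m ≡ sumQ (λ k → toℚ (conv c k) * x ^ℚ k) m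
    lagged≡sumQ-conv zero    = sumQ-zero N _ (λ i _ → *-zeroʳ (β i))
    lagged≡sumQ-conv (suc m) = begin
      sumQ (λ i → β i * s (m ∸ i)) N
        ≡⟨ sumQ-cong N (λ i _ → lagged-term m i) ⟩
      sumQ (λ i → β i * s (m ∸ suc i) + toℚ (α i ℕ.* prev c (m ∸ i)) * x ^ℚ m) N
        ≡⟨ sumQ-+ N _ _ ⟩
      lagged m + sumQ (λ i → toℚ (α i ℕ.* prev c (m ∸ i)) * x ^ℚ m) N
        ≡⟨ cong (lagged m +_) (trans (sumQ-*ʳ N _ (x ^ℚ m)) (cong (_* x ^ℚ m) (≡.sym (toℚ-sumℕ _ N)))) ⟩
      lagged m + toℚ (conv c m) * x ^ℚ m
        ≡⟨ cong (_+ toℚ (conv c m) * x ^ℚ m) (lagged≡sumQ-conv m) ⟩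
      sumQ (λ k → toℚ (conv c k) * x ^ℚ k) (suc m) ∎
      where open ≡-Reasoning

    g*s≡lagged+W : ∀ m → sumQ β N * s m ≡ lagged m + W m
    g*s≡lagged+W m = begin
      sumQ β N * s m                   ≡⟨ ≡.sym (sumQ-*ʳ N β (s m)) ⟩
      sumQ (λ i → β i * s m) N         ≡⟨ sumQ-cong N (λ i _ → solve 3 (λ b S T → b :* S := b :* T :+ b :* (S :- T)) refl (β i) (s m) (s (m ∸ suc i))) ⟩
      sumQ (λ i → β i * s (m ∸ suc i) + β i * (s m - s (m ∸ suc i))) N ≡⟨ sumQ-+ N _ _ ⟩
      lagged m + W m                   ∎
      where open ≡-Reasoning

  conv-zero : ∀ c → conv c 0 ≡ 0
  conv-zero c = sumℕ-extend {m = 0} {N} ℕ.z≤n (λ i _ _ → trans (cong (α i ℕ.*_) (prev-∸-≥ c {0} {i} ℕ.z≤n)) (ℕ.*-zeroʳ (α i)))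

  A B : ℕ
  A = sumℕ α N
  B = suc A

  0<toℚB : 0ℚ < toℚ B
  0<toℚB = toℚ-mono-< {0} {B} (ℕ.s≤s ℕ.z≤n)

  instance
    toℚB≢0 : NonZero (toℚ B)
    toℚB≢0 = >-nonZero 0<toℚB

  radius : ℚ
  radius = ½ * 1/ toℚ B

  0<radius : 0ℚ < radius
  0<radius = 0<* (positive⁻¹ ½) 0<1/B
    where
    0<1/B : 0ℚ < 1/ toℚ B
    0<1/B = positive⁻¹ _ {{1/pos⇒pos (toℚ B) {{positive 0<toℚB}}}}

  B*radius≡½ : toℚ B * radius ≡ ½
  B*radius≡½ = trans (solve 3 (λ b h v → b :* (h :* v) := h :* (b :* v)) refl (toℚ B) ½ (1/ toℚ B))
    (trans (cong (½ *_) (*-inverseʳ (toℚ B))) (*-identityʳ ½))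

  module _ {c : ℕ → ℕ} (rec : ∀ n → c n ℕ.+ δ n N ≡ conv c n ℕ.+ δ n 0) where

    c-bound : ∀ n → c n ℕ.≤ B ℕ.^ n
    c-bound = <-rec _ bound
      where
      open ℕ.≤-Reasoning
      bound : ∀ n → (∀ {j} → j ℕ.< n → c j ℕ.≤ B ℕ.^ j) → c n ℕ.≤ B ℕ.^ n
      bound zero    _  = begin
        c 0               ≤⟨ ℕ.m≤m+n (c 0) (δ 0 N) ⟩
        c 0 ℕ.+ δ 0 N     ≡⟨ rec 0 ⟩
        conv c 0 ℕ.+ 1    ≡⟨ cong (ℕ._+ 1) (conv-zero c) ⟩
        1                 ∎
      bound (suc n) ih = begin
        c (suc n)                          ≤⟨ ℕ.m≤m+n (c (suc n)) (δ (suc n) N) ⟩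
        c (suc n) ℕ.+ δ (suc n) N          ≡⟨ rec (suc n) ⟩
        conv c (suc n) ℕ.+ 0               ≡⟨ ℕ.+-identityʳ _ ⟩
        conv c (suc n)                     ≤⟨ sumℕ-mono-≤ N (λ i _ → ℕ.*-monoʳ-≤ (α i) (prev-≤ (suc n ∸ i) (ℕ.m∸n≤m (suc n) i))) ⟩
        sumℕ (λ i → α i ℕ.* B ℕ.^ n) N     ≡⟨ sumℕ-*ʳ α (B ℕ.^ n) N ⟩
        A ℕ.* B ℕ.^ n                      ≤⟨ ℕ.*-monoˡ-≤ (B ℕ.^ n) (ℕ.n≤1+n A) ⟩
        B ℕ.* B ℕ.^ n                      ∎
        where
        prev-≤ : ∀ k → k ℕ.≤ suc n → prev c k ℕ.≤ B ℕ.^ n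
        prev-≤ zero    _             = ℕ.z≤n
        prev-≤ (suc j) (ℕ.s≤s j≤n) = ℕ.≤-trans (ih (ℕ.s≤s j≤n)) (ℕ.^-monoʳ-≤ B j≤n)

    module _ (x : ℚ) where

      open PartialSums c x

      s+x^N≡lagged+1 : ∀ {m} → N ℕ.< m → s m + x ^ℚ N ≡ lagged m + 1ℚ
      s+x^N≡lagged+1 {m} N<m = begin
        s m + x ^ℚ N
          ≡⟨ cong (s m +_) (≡.sym (sumQ-δ (x ^ℚ_) N<m)) ⟩
        s m + sumQ (λ k → toℚ (δ k N) * x ^ℚ k) m
          ≡⟨ ≡.sym (sumQ-toℚ-+ m c (λ k → δ k N) (x ^ℚ_)) ⟩
        sumQ (λ k → toℚ (c k ℕ.+ δ k N) * x ^ℚ k) m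
          ≡⟨ sumQ-cong m (λ k _ → cong (λ n → toℚ n * x ^ℚ k) (rec k)) ⟩
        sumQ (λ k → toℚ (conv c k ℕ.+ δ k 0) * x ^ℚ k) m
          ≡⟨ sumQ-toℚ-+ m (conv c) (λ k → δ k 0) (x ^ℚ_) ⟩
        sumQ (λ k → toℚ (conv c k) * x ^ℚ k) m + sumQ (λ k → toℚ (δ k 0) * x ^ℚ k) m
          ≡⟨ cong₂ _+_ (≡.sym (lagged≡sumQ-conv m)) (sumQ-δ (x ^ℚ_) (ℕ.≤-<-trans ℕ.z≤n N<m)) ⟩
        lagged m + 1ℚ ∎
        where open ≡-Reasoning

      F*s≡1-x^N-W : ∀ {m} → N ℕ.< m → F x * s m ≡ (1ℚ - x ^ℚ N) - W m
      F*s≡1-x^N-W {m} N<m = begin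
        (1ℚ - sumQ β N) * s m
          ≡⟨ solve 2 (λ G S → (con 1ℚ :- G) :* S := S :- G :* S) refl (sumQ β N) (s m) ⟩
        s m - sumQ β N * s m
          ≡⟨ cong (λ u → s m - u) (g*s≡lagged+W m) ⟩
        s m - (lagged m + W m)
          ≡⟨ solve 4 (λ S P L V → S :- (L :+ V) := ((con 1ℚ :- P) :- V) :+ ((S :+ P) :- (L :+ con 1ℚ)))
               refl (s m) (x ^ℚ N) (lagged m) (W m) ⟩
        ((1ℚ - x ^ℚ N) - W m) + ((s m + x ^ℚ N) - (lagged m + 1ℚ))
          ≡⟨ cong (λ u → ((1ℚ - x ^ℚ N) - W m) + (u - (lagged m + 1ℚ))) (s+x^N≡lagged+1 N<m) ⟩
        ((1ℚ - x ^ℚ N) - W m) + ((lagged m + 1ℚ) - (lagged m + 1ℚ))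
          ≡⟨ cong (((1ℚ - x ^ℚ N) - W m) +_) (+-inverseʳ (lagged m + 1ℚ)) ⟩
        ((1ℚ - x ^ℚ N) - W m) + 0ℚ
          ≡⟨ +-identityʳ _ ⟩
        (1ℚ - x ^ℚ N) - W m ∎
        where open ≡-Reasoning

      module Estimates (∣x∣<radius : ∣ x ∣ < radius) where

        ρ : ℚ
        ρ = toℚ B * ∣ x ∣

        0≤∣x∣ : 0ℚ ≤ ∣ x ∣
        0≤∣x∣ = 0≤∣p∣ x

        0≤ρ : 0ℚ ≤ ρ
        0≤ρ = 0≤* (0≤toℚ B) 0≤∣x∣

        ρ≤½ : ρ ≤ ½
        ρ≤½ = ≤-trans (*-monoˡ-≤′ (0≤toℚ B) (<⇒≤ ∣x∣<radius)) (≤-reflexive B*radius≡½)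

        ∣x∣≤ρ : ∣ x ∣ ≤ ρ
        ∣x∣≤ρ = ≤-trans (≤-reflexive (≡.sym (*-identityˡ ∣ x ∣))) (*-monoʳ-≤′ 0≤∣x∣ (toℚ-mono-≤ {1} {B} (ℕ.s≤s ℕ.z≤n)))

        ½≤1 : ½ ≤ 1ℚ
        ½≤1 = *≤* (ℤ.+≤+ (ℕ.s≤s ℕ.z≤n))

        ∣x∣≤1 : ∣ x ∣ ≤ 1ℚ
        ∣x∣≤1 = ≤-trans ∣x∣≤ρ (≤-trans ρ≤½ ½≤1)

        ∣toℚ∣ : ∀ n → ∣ toℚ n ∣ ≡ toℚ n
        ∣toℚ∣ n = 0≤p⇒∣p∣≡p (0≤toℚ n)

        ∣β∣ : ∀ i → ∣ β i ∣ ≡ toℚ (α i) * ∣ x ∣ ^ℚ suc i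
        ∣β∣ i = trans (∣p*q∣≡∣p∣*∣q∣ (toℚ (α i)) (x ^ℚ suc i)) (cong₂ _*_ (∣toℚ∣ (α i)) (∣^ℚ∣ x (suc i)))

        ∣t∣≤ρ^ : ∀ k → ∣ t k ∣ ≤ ρ ^ℚ k
        ∣t∣≤ρ^ k = begin
          ∣ t k ∣                      ≡⟨ trans (∣p*q∣≡∣p∣*∣q∣ (toℚ (c k)) (x ^ℚ k)) (cong₂ _*_ (∣toℚ∣ (c k)) (∣^ℚ∣ x k)) ⟩
          toℚ (c k) * ∣ x ∣ ^ℚ k       ≤⟨ *-monoʳ-≤′ (0≤^ℚ k 0≤∣x∣) (≤-trans (toℚ-mono-≤ (c-bound k)) (≤-reflexive (toℚ-^ B k))) ⟩
          toℚ B ^ℚ k * ∣ x ∣ ^ℚ k      ≡⟨ ≡.sym (^ℚ-* (toℚ B) ∣ x ∣ k) ⟩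
          ρ ^ℚ k                       ∎
          where open ≤-Reasoning

        ∣g∣≤ρ : ∣ sumQ β N ∣ ≤ ρ
        ∣g∣≤ρ = begin
          ∣ sumQ β N ∣                             ≤⟨ ∣sumQ∣≤sumQ∣∣ N β ⟩
          sumQ (λ i → ∣ β i ∣) N                   ≤⟨ sumQ-mono-≤ N (λ i _ → ≤-trans (≤-reflexive (∣β∣ i)) (*-monoˡ-≤′ (0≤toℚ (α i)) (∣x∣^1+i≤∣x∣ i))) ⟩
          sumQ (λ i → toℚ (α i) * ∣ x ∣) N         ≡⟨ trans (sumQ-*ʳ N (λ i → toℚ (α i)) ∣ x ∣) (cong (_* ∣ x ∣) (≡.sym (toℚ-sumℕ α N))) ⟩
          toℚ A * ∣ x ∣                            ≤⟨ *-monoʳ-≤′ 0≤∣x∣ (toℚ-mono-≤ (ℕ.n≤1+n A)) ⟩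
          ρ                                        ∎
          where
          open ≤-Reasoning
          ∣x∣^1+i≤∣x∣ : ∀ i → ∣ x ∣ ^ℚ suc i ≤ ∣ x ∣
          ∣x∣^1+i≤∣x∣ i = ≤-trans (*-monoˡ-≤′ 0≤∣x∣ (^ℚ-≤1 i 0≤∣x∣ ∣x∣≤1)) (≤-reflexive (*-identityʳ ∣ x ∣))

        1≡F+g : 1ℚ ≡ F x + sumQ β N
        1≡F+g = solve 1 (λ g → con 1ℚ := (con 1ℚ :- g) :+ g) refl (sumQ β N)

        ½≤∣F∣ : ½ ≤ ∣ F x ∣
        ½≤∣F∣ = begin
          ½                              ≡⟨ refl ⟩
          ∣ 1ℚ ∣ - ½                     ≡⟨ cong (λ u → ∣ u ∣ - ½) {1ℚ} {F x + sumQ β N} 1≡F+g ⟩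
          ∣ F x + sumQ β N ∣ - ½         ≤⟨ +-monoˡ-≤ (- ½) (∣p+q∣≤∣p∣+∣q∣ (F x) (sumQ β N)) ⟩
          ∣ F x ∣ + ∣ sumQ β N ∣ - ½     ≤⟨ +-monoˡ-≤ (- ½) (+-monoʳ-≤ ∣ F x ∣ (≤-trans ∣g∣≤ρ ρ≤½)) ⟩
          ∣ F x ∣ + ½ - ½                ≡⟨ solve 1 (λ f → f :+ con ½ :- con ½ := f) refl ∣ F x ∣ ⟩
          ∣ F x ∣                        ∎
          where open ≤-Reasoning

        F≢0 : F x ≢ 0ℚ
        F≢0 F≡0 = <-irrefl refl (<-≤-trans (positive⁻¹ ½) (≤-trans ½≤∣F∣ (≤-reflexive (cong ∣_∣ F≡0))))

        ∣x∣^k*∣s-s∣≤ : ∀ m k → k ℕ.≤ m → ∣ x ∣ ^ℚ k * ∣ s m - s (m ∸ k) ∣ ≤ toℚ k * ρ ^ℚ m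
        ∣x∣^k*∣s-s∣≤ m zero    _     = ≤-reflexive (trans (cong (λ u → 1ℚ * ∣ u ∣) (+-inverseʳ (s m))) (≡.sym (*-zeroˡ (ρ ^ℚ m))))
        ∣x∣^k*∣s-s∣≤ m (suc k) 1+k≤m = begin
          ∣ x ∣ ^ℚ suc k * ∣ s m - s j ∣                  ≡⟨ cong (λ u → ∣ x ∣ ^ℚ suc k * ∣ u ∣) split ⟩
          ∣ x ∣ ^ℚ suc k * ∣ D + t j ∣                    ≤⟨ *-monoˡ-≤′ (0≤^ℚ (suc k) 0≤∣x∣) (∣p+q∣≤∣p∣+∣q∣ D (t j)) ⟩
          ∣ x ∣ ^ℚ suc k * (∣ D ∣ + ∣ t j ∣)              ≡⟨ solve 4 (λ a P d T → (a :* P) :* (d :+ T) := a :* (P :* d) :+ (a :* P) :* T)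
                                                               refl ∣ x ∣ (∣ x ∣ ^ℚ k) (∣ D ∣) (∣ t j ∣) ⟩
          ∣ x ∣ * (∣ x ∣ ^ℚ k * ∣ D ∣) + ∣ x ∣ ^ℚ suc k * ∣ t j ∣
            ≤⟨ +-mono-≤ (*-mono-≤′ 0≤∣x∣ (0≤* (0≤^ℚ k 0≤∣x∣) (0≤∣p∣ D)) ∣x∣≤1 (∣x∣^k*∣s-s∣≤ m k (ℕ.<⇒≤ 1+k≤m)))
                        (*-mono-≤′ (0≤^ℚ (suc k) 0≤∣x∣) (0≤∣p∣ (t j)) (^ℚ-mono-≤ (suc k) 0≤∣x∣ ∣x∣≤ρ) (∣t∣≤ρ^ j)) ⟩
          1ℚ * (toℚ k * ρ ^ℚ m) + ρ ^ℚ suc k * ρ ^ℚ j    ≡⟨ cong (1ℚ * (toℚ k * ρ ^ℚ m) +_) (trans (≡.sym (^ℚ-+ ρ (suc k) j)) (cong (ρ ^ℚ_) (ℕ.m+[n∸m]≡n 1+k≤m))) ⟩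
          1ℚ * (toℚ k * ρ ^ℚ m) + ρ ^ℚ m                 ≡⟨ solve 2 (λ K R → con 1ℚ :* (K :* R) :+ R := (con 1ℚ :+ K) :* R) refl (toℚ k) (ρ ^ℚ m) ⟩
          (1ℚ + toℚ k) * ρ ^ℚ m                          ≡⟨ cong (_* ρ ^ℚ m) (≡.sym (toℚ-+ 1 k)) ⟩
          toℚ (suc k) * ρ ^ℚ m                           ∎
          where
          open ≤-Reasoning
          j = m ∸ suc k
          D = s m - s (m ∸ k)
          split : s m - s j ≡ D + t j
          split = trans (solve 3 (λ S U T → S :- U := (S :- (U :+ T)) :+ T) refl (s m) (s j) (t j))
            (cong (λ u → (s m - s u) + t j) (≡.sym (ℕ.+-∸-assoc 1 1+k≤m)))

        ∣W∣≤ : ∀ m → N ℕ.≤ m → ∣ W m ∣ ≤ toℚ A * (toℚ N * ρ ^ℚ m)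
        ∣W∣≤ m N≤m = begin
          ∣ W m ∣                                              ≤⟨ ∣sumQ∣≤sumQ∣∣ N _ ⟩
          sumQ (λ i → ∣ β i * (s m - s (m ∸ suc i)) ∣) N       ≤⟨ sumQ-mono-≤ N term≤ ⟩
          sumQ (λ i → toℚ (α i) * (toℚ N * ρ ^ℚ m)) N          ≡⟨ sumQ-*ʳ N _ _ ⟩
          sumQ (λ i → toℚ (α i)) N * (toℚ N * ρ ^ℚ m)          ≡⟨ cong (_* (toℚ N * ρ ^ℚ m)) (≡.sym (toℚ-sumℕ α N)) ⟩
          toℚ A * (toℚ N * ρ ^ℚ m)                             ∎
          where
          open ≤-Reasoning
          term≤ : ∀ i → i ℕ.< N → ∣ β i * (s m - s (m ∸ suc i)) ∣ ≤ toℚ (α i) * (toℚ N * ρ ^ℚ m)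
          term≤ i i<N = begin
            ∣ β i * (s m - s (m ∸ suc i)) ∣                          ≡⟨ trans (∣p*q∣≡∣p∣*∣q∣ (β i) _) (cong (_* ∣ s m - s (m ∸ suc i) ∣) (∣β∣ i)) ⟩
            toℚ (α i) * ∣ x ∣ ^ℚ suc i * ∣ s m - s (m ∸ suc i) ∣     ≡⟨ *-assoc (toℚ (α i)) _ _ ⟩
            toℚ (α i) * (∣ x ∣ ^ℚ suc i * ∣ s m - s (m ∸ suc i) ∣)   ≤⟨ *-monoˡ-≤′ (0≤toℚ (α i)) (∣x∣^k*∣s-s∣≤ m (suc i) (ℕ.≤-trans i<N N≤m)) ⟩
            toℚ (α i) * (toℚ (suc i) * ρ ^ℚ m)                       ≤⟨ *-monoˡ-≤′ (0≤toℚ (α i)) (*-monoʳ-≤′ (0≤^ℚ m 0≤ρ) (toℚ-mono-≤ i<N)) ⟩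
            toℚ (α i) * (toℚ N * ρ ^ℚ m)                             ∎

        instance
          F≢0′ : NonZero (F x)
          F≢0′ = ≢-nonZero F≢0

        limit : ℚ
        limit = (1ℚ - x ^ℚ N) ÷ F x

        ∣s-limit∣≤2∣W∣ : ∀ {m} → N ℕ.< m → ∣ s m - limit ∣ ≤ toℚ 2 * ∣ W m ∣
        ∣s-limit∣≤2∣W∣ {m} N<m = begin
          ∣ s m - limit ∣                      ≡⟨ ≡.sym (*-identityʳ _) ⟩
          ∣ s m - limit ∣ * 1ℚ                 ≤⟨ *-monoˡ-≤′ (0≤∣p∣ (s m - limit)) (*-monoˡ-≤′ (0≤toℚ 2) ½≤∣F∣) ⟩
          ∣ s m - limit ∣ * (toℚ 2 * ∣ F x ∣)  ≡⟨ solve 3 (λ a b f → a :* (b :* f) := b :* (a :* f)) refl (∣ s m - limit ∣) (toℚ 2) ∣ F x ∣ ⟩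
          toℚ 2 * (∣ s m - limit ∣ * ∣ F x ∣)  ≡⟨ cong (toℚ 2 *_) (≡.sym (∣p*q∣≡∣p∣*∣q∣ (s m - limit) (F x))) ⟩
          toℚ 2 * ∣ (s m - limit) * F x ∣      ≡⟨ cong (λ u → toℚ 2 * ∣ u ∣) [s-limit]*F≡-W ⟩
          toℚ 2 * ∣ - W m ∣                    ≡⟨ cong (toℚ 2 *_) (∣-p∣≡∣p∣ (W m)) ⟩
          toℚ 2 * ∣ W m ∣                      ∎
          where
          open ≤-Reasoning
          P = 1ℚ - x ^ℚ N
          [s-limit]*F≡-W : (s m - limit) * F x ≡ - W m
          [s-limit]*F≡-W = begin-equality
            (s m - P * 1/ F x) * F x     ≡⟨ solve 4 (λ S Q v f → (S :- Q :* v) :* f := f :* S :- Q :* (v :* f)) refl (s m) P (1/ F x) (F x) ⟩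
            F x * s m - P * (1/ F x * F x) ≡⟨ cong (λ u → F x * s m - P * u) (*-inverseˡ (F x)) ⟩
            F x * s m - P * 1ℚ           ≡⟨ cong (λ u → u - P * 1ℚ) (F*s≡1-x^N-W N<m) ⟩
            (P - W m) - P * 1ℚ           ≡⟨ solve 2 (λ Q V → (Q :- V) :- Q :* con 1ℚ := :- V) refl P (W m) ⟩
            - W m                        ∎

        K : ℕ
        K = 2 ℕ.* (A ℕ.* N)

        ∣s-limit∣≤K½^m : ∀ {m} → N ℕ.< m → ∣ s m - limit ∣ ≤ toℚ K * ½ ^ℚ m
        ∣s-limit∣≤K½^m {m} N<m = begin
          ∣ s m - limit ∣                       ≤⟨ ∣s-limit∣≤2∣W∣ N<m ⟩
          toℚ 2 * ∣ W m ∣                       ≤⟨ *-monoˡ-≤′ (0≤toℚ 2) (∣W∣≤ m (ℕ.<⇒≤ N<m)) ⟩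
          toℚ 2 * (toℚ A * (toℚ N * ρ ^ℚ m))    ≤⟨ *-monoˡ-≤′ (0≤toℚ 2) (*-monoˡ-≤′ (0≤toℚ A) (*-monoˡ-≤′ (0≤toℚ N) (^ℚ-mono-≤ m 0≤ρ ρ≤½))) ⟩
          toℚ 2 * (toℚ A * (toℚ N * ½ ^ℚ m))    ≡⟨ solve 4 (λ a b n h → a :* (b :* (n :* h)) := (a :* (b :* n)) :* h) refl (toℚ 2) (toℚ A) (toℚ N) (½ ^ℚ m) ⟩
          toℚ 2 * (toℚ A * toℚ N) * ½ ^ℚ m      ≡⟨ cong (_* ½ ^ℚ m) (≡.sym toℚK) ⟩
          toℚ K * ½ ^ℚ m                        ∎
          where
          open ≤-Reasoning
          toℚK : toℚ K ≡ toℚ 2 * (toℚ A * toℚ N)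
          toℚK = trans (toℚ-* 2 (A ℕ.* N)) (cong (toℚ 2 *_) (toℚ-* A N))

        converges : SeriesConvergesTo t limit
        converges ε 0<ε = suc N ℕ.+ M , λ m 1+N+M≤m →
          ≤-<-trans (∣s-limit∣≤K½^m (ℕ.≤-trans (ℕ.m≤m+n (suc N) M) 1+N+M≤m)) (decay m (ℕ.≤-trans (ℕ.m≤n+m M (suc N)) 1+N+M≤m))
          where
          M : ℕ
          M = proj₁ (geometric-decay K ε 0<ε)
          decay : ∀ m → M ℕ.≤ m → toℚ K * ½ ^ℚ m < ε
          decay = proj₂ (geometric-decay K ε 0<ε)

    generating-function : ∀ x → ∣ x ∣ < radius →
      Σ (F x ≢ 0ℚ) λ F≢0 → SeriesConvergesTo (λ k → toℚ (c k) * x ^ℚ k) (_÷_ (1ℚ - x ^ℚ N) (F x) {{≢-nonZero F≢0}})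
    generating-function x ∣x∣<radius = F≢0 , converges
      where open Estimates x ∣x∣<radius

module CharacteristicPolynomial (N′ : ℕ) (e : ℕ → ℕ) where

  open Sequences using (δ-refl; δ-≢)
  open RationalFacts using (toℚ; sumQ-cong)
  open FiniteRecurrence N′ e using (N; coeff)
  open import Data.Nat as ℕ using (suc)
  import Data.Nat.Properties as ℕ
  open import Data.Rational using (ℚ; 1ℚ; _+_; _*_; _-_)
  open import Data.Rational.Solver using (module +-*-Solver)
  open +-*-Solver using (solve; _:+_; _:-_; _:=_; con)
  open import Relation.Binary.PropositionalEquality

  fPoly≡F : ∀ x → fPoly N e x ≡ GeneratingFunction.F N (λ i → coeff (suc i)) x
  fPoly≡F x = begin
    (1ℚ - S) - toℚ (suc (e N)) * x ^ℚ N
      ≡⟨ solve 2 (λ s t → (con 1ℚ :- s) :- t := con 1ℚ :- (s :+ t)) refl S (toℚ (suc (e N)) * x ^ℚ N) ⟩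
    1ℚ - (S + toℚ (suc (e N)) * x ^ℚ N)
      ≡⟨ cong₂ (λ s a → 1ℚ - (s + toℚ a * x ^ℚ N))
           (sumQ-cong N′ (λ i i<N′ → cong (λ a → toℚ a * x ^ℚ suc i)
             (sym (trans (cong (e (suc i) ℕ.+_) (δ-≢ (ℕ.<⇒≢ i<N′))) (ℕ.+-identityʳ (e (suc i)))))))
           (sym (trans (cong (e N ℕ.+_) (δ-refl N′)) (ℕ.+-comm (e N) 1))) ⟩
    1ℚ - (sumQ (λ i → toℚ (coeff (suc i)) * x ^ℚ suc i) N′ + toℚ (coeff N) * x ^ℚ N) ∎
    where
    open ≡-Reasoning
    S : ℚ
    S = sumQ (λ k → toℚ (e (suc k)) * x ^ℚ suc k) N′

open import Data.Nat using (ℕ; _≤_)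
open import Data.Product using (Σ; _×_)
open import Relation.Binary.PropositionalEquality using (_≢_)
open import Data.Rational using (ℚ; 0ℚ; 1ℚ; _<_; _*_; _-_; _÷_; _/_; ∣_∣; ≢-nonZero; NonZero)
open import Data.Integer using (+_)

proposition4p9 :
    (N : ℕ) (e : ℕ → ℕ) → 2 ≤ N → e 1 ≢ 0 →
    (C : ℕ → ℕ) → (∀ n → HasCard (InS N e n) (C n)) →
    Σ ℚ λ r → (0ℚ < r) ×
      (∀ (x : ℚ) → ∣ x ∣ < r →
        Σ (fPoly N e x ≢ 0ℚ) λ f≢0 →
          SeriesConvergesTo (λ k → ((+ C k) / 1) * (x ^ℚ k))
            (_÷_ (1ℚ - (x ^ℚ N)) (fPoly N e x) {{≢-nonZero f≢0}}))
proposition4p9 (ℕ.suc N′) e (ℕ.s≤s _) e₁≢0 C C-card =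
  radius , 0<radius , λ x ∣x∣<radius →
    subst (λ f → Σ (f ≢ 0ℚ) λ f≢0 → SeriesConvergesTo (λ k → ((+ C k) / 1) * (x ^ℚ k)) (_÷_ (1ℚ - (x ^ℚ N)) f {{≢-nonZero f≢0}}))
      (sym (fPoly≡F x)) (generating-function {C} (recurrence C-zero C-suc) x ∣x∣<radius)
  where
  open import Data.Product using (_,_)
  open import Relation.Binary.PropositionalEquality using (subst; sym)
  open import Data.Nat.Properties using (n≢0⇒n>0)
  open FiniteRecurrence N′ e using (N; coeff; recurrence)
  open CharacteristicPolynomial N′ e using (fPoly≡F)
  open GeneratingFunction N (λ i → coeff (ℕ.suc i)) using (radius; 0<radius; generating-function)
  e₁>0 : 0 ℕ.< maxBlock N e 1 1
  e₁>0 = subst (0 ℕ.<_) (sym (Blocks.maxBlock-≥ N e {1} {1} (ℕ.s≤s ℕ.z≤n))) (n≢0⇒n>0 e₁≢0)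
  open Counting N e C C-card e₁>0 using (C-zero; C-suc)
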